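{- Let $k$ be a positive integer and $\mathcal C$ a $c$-good $k$-configuration whose solution space (as a linear system in $x_1,\dots,x_k$ over $\mathbb Q$) has dimension $d$. Then $\mathcal C$ certifies at most $(k-d)(k-d+1)$ pairs.
   Context: Standing parameters: $\varepsilon,k_0,c$ satisfy $0<\varepsilon\le 1/4096$, $k_0\ge 32/\varepsilon^2$ and $2-\min\{\varepsilon^2/32,\,2/k_0\}\le c\le 2$. All linear equations are over $\mathbb Q$ in variables $x_1,\dots,x_k$, considered up to rearrangement but not scaling; the content of an equation is an expression $*$ with the equation reading $*=0$. Equations are independent if their contents are linearly independent; a collection implies an equation if its content is a $\mathbb Q$-linear combination of the contents of the collection. An equation contains a variable if its coefficient is nonzero. A difference equality is a nontrivial equation $x_{i_1}-x_{i_2}=x_{i_3}-x_{i_4}$ ($i_1,\dots,i_4\in[k]$ not necessarily distinct). A $k$-configuration is a system of difference equalities in $x_1,\dots,x_k$. A collection of difference equalities is valid if it does not imply $x_a=x_b$ for $a\ne b$; collinearity-free if it implies no equation containing exactly three variables; $c$-light if for every $t\ge1$ any $t$ independent equations it implies together contain at least $ct+1$ variables; $c$-good if valid, collinearity-free and $c$-light. For $a>b$ in $[k]$, a collection certifies the pair $(a,b)$ if it implies $x_a-x_b=x_{a'}-x_{b'}$ for some $(a',b')\in[k]^2$ with either $a',b'<a$, or $b'=a$ and $a'<b$; the number of pairs certified counts such $(a,b)$.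
   Formalization: The standing parameters $\varepsilon$, $k_0$ and $c$ range over the rationals. -}

module Defs where

open import Data.Nat as ℕ using (ℕ; zero; suc)
open import Data.Integer using (+_)
open import Data.Fin as Fin using (Fin; zero; suc)
open import Data.Fin.Properties using (_≟_)
open import Data.Rational as ℚ using (ℚ; 0ℚ; 1ℚ; _+_; _*_; _-_; _/_)
open import Data.Rational.Properties using () renaming (_≟_ to _≟ℚ_)
open import Data.Product using (Σ; ∃; ∃-syntax; _×_; _,_)
open import Data.Sum using (_⊎_)
open import Data.List using (List; length; filter)
open import Data.List.Base using (allFin)
open import Data.List.Relation.Unary.Unique.Propositional using (Unique)
open import Data.List.Relation.Unary.All using (All)
open import Relation.Binary.PropositionalEquality using (_≡_; _≢_)
open import Relation.Nullary using (¬_; Dec; yes; no)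
open import Relation.Nullary.Decidable using (¬?)
open import Data.Fin.Properties using (any?)

-- Rational vectors indexed by the k variables: an equation's content
-- (coefficient of x_i at index i); the equation reads content = 0.
Vecℚ : ℕ → Set
Vecℚ k = Fin k → ℚ

ℕ→ℚ : ℕ → ℚ
ℕ→ℚ n = + n / 1

sumFin : ∀ {m} → (Fin m → ℚ) → ℚ
sumFin {zero}  f = 0ℚ
sumFin {suc m} f = f zero + sumFin (λ j → f (suc j))

unit : ∀ {k} → Fin k → Vecℚ k
unit i j with i ≟ j
... | yes _ = 1ℚ
... | no  _ = 0ℚ

_⊕_ : ∀ {k} → Vecℚ k → Vecℚ k → Vecℚ k
(u ⊕ v) i = u i + v i

_⊖_ : ∀ {k} → Vecℚ k → Vecℚ k → Vecℚ k
(u ⊖ v) i = u i - v i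

lincomb : ∀ {k m} → (Fin m → Vecℚ k) → (Fin m → ℚ) → Vecℚ k
lincomb w μ i = sumFin (λ j → μ j * w j i)

dot : ∀ {k} → Vecℚ k → Vecℚ k → ℚ
dot u x = sumFin (λ i → u i * x i)

Independent : ∀ {k t} → (Fin t → Vecℚ k) → Set
Independent w = ∀ μ → (∀ i → lincomb w μ i ≡ 0ℚ) → ∀ j → μ j ≡ 0ℚ

-- A difference equality x_{i1} - x_{i2} = x_{i3} - x_{i4} is given by (i1,i2,i3,i4)
DiffEq : ℕ → Set
DiffEq k = Fin k × Fin k × Fin k × Fin k

content : ∀ {k} → DiffEq k → Vecℚ k
content (i₁ , i₂ , i₃ , i₄) = ((unit i₁ ⊖ unit i₂) ⊖ unit i₃) ⊕ unit i₄

Nontrivial : ∀ {k} → DiffEq k → Set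
Nontrivial e = ¬ (∀ i → content e i ≡ 0ℚ)

Config : ℕ → ℕ → Set
Config k m = Fin m → DiffEq k

IsConfig : ∀ {k m} → Config k m → Set
IsConfig C = ∀ j → Nontrivial (C j)

Implies : ∀ {k m} → Config k m → Vecℚ k → Set
Implies C v = ∃[ μ ] (∀ i → v i ≡ lincomb (λ j → content (C j)) μ i)

varCount : ∀ {k t} → (Fin t → Vecℚ k) → ℕ
varCount {k} w = length (filter (λ i → any? (λ j → ¬? (w j i ≟ℚ 0ℚ))) (allFin k))

Valid : ∀ {k m} → Config k m → Set
Valid C = ∀ a b → a ≢ b → ¬ Implies C (unit a ⊖ unit b)

CollinearityFree : ∀ {k m} → Config k m → Set
CollinearityFree C = ∀ v → Implies C v → varCount (λ (_ : Fin 1) → v) ≢ 3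

Light : ∀ {k m} → ℚ → Config k m → Set
Light {k} c C = ∀ t → 1 ℕ.≤ t → (w : Fin t → Vecℚ k) →
  (∀ j → Implies C (w j)) → Independent w →
  c * ℕ→ℚ t + 1ℚ ℚ.≤ ℕ→ℚ (varCount w)

Good : ∀ {k m} → ℚ → Config k m → Set
Good c C = Valid C × CollinearityFree C × Light c C

Solution : ∀ {k m} → Config k m → Vecℚ k → Set
Solution C x = ∀ j → dot (content (C j)) x ≡ 0ℚ

SolutionDim : ∀ {k m} → Config k m → ℕ → Set
SolutionDim {k} C d = ∃[ B ] ((∀ j → Solution C (B j)) × Independent {k} {d} B ×
  (∀ x → Solution C x → ∃[ μ ] (∀ i → x i ≡ lincomb B μ i)))

Certifies : ∀ {k m} → Config k m → Fin k × Fin k → Set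
Certifies C (a , b) = b Fin.< a × ∃[ a′ ] ∃[ b′ ]
  (((a′ Fin.< a × b′ Fin.< a) ⊎ (b′ ≡ a × a′ Fin.< b)) ×
   Implies C (((unit a ⊖ unit b) ⊖ unit a′) ⊕ unit b′))

CertifiesAtMost : ∀ {k m} → Config k m → ℕ → Set
CertifiesAtMost C N = ∀ (ps : List _) → Unique ps → All (Certifies C) ps → length ps ℕ.≤ N

-- standing parameters (ε,k₀,c). Division-free but equivalent forms:
-- k₀ ≥ 32/ε² ⇔ 32 ≤ k₀ε² (ε>0); c ≥ 2 - min{ε²/32, 2/k₀} ⇔ c ≥ 2 - ε²/32 and (2-c)k₀ ≤ 2 (k₀>0).
StandingParams : ℚ → ℚ → ℚ → Set
StandingParams ε k₀ c =
  0ℚ ℚ.< ε × ε ℚ.≤ + 1 / 4096 ×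
  ℕ→ℚ 32 ℚ.≤ k₀ * (ε * ε) ×
  ℕ→ℚ 2 - ε * ε * (+ 1 / 32) ℚ.≤ c × (ℕ→ℚ 2 - c) * k₀ ℚ.≤ ℕ→ℚ 2 ×
  c ℚ.≤ ℕ→ℚ 2

module Submission where

-- Every certificate of a pair (a , b) is a parallelogram x_a − x_b = x_{a′} − x_{b′} whose other
-- three corners lie below a: the degenerate shapes (b′ = a, or a repeated index) would be implied
-- equations in at most three variables, which lightness and collinearity-freeness exclude.
-- Fix an apex a. Pruning the certificates of the pairs (a , _) to an irredundant subfamily gives
-- parallelograms each owning a private side, and the sides of the subfamily still cover every b.
-- Such a family is independent: in a dependency with all coefficients nonzero each private side
-- must reappear as the opposite corner of another member, so "mate" is a bijection and each
-- other side occurs twice; then the family lives on too few variables for c ≥ 63/32 (five or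
-- more members), or its sum is an implied equation in at most three variables (at most four).
-- So the layer of pairs with first entry a has at most twice as many elements as it yields
-- independent implied equations supported on indices ≤ a. Going down from the top apex, every
-- nonempty layer also adds an equation with a new leading index, and implied equations are
-- orthogonal to the d-dimensional solution space; hence below s nonempty layers the next one
-- yields at most r − s equations, r = k − d, and the total is at most Σ_{s<r} 2(r − s) = r(r + 1).

open import Defs

-- The development is wrapped in a module so that its rational operations stay out of scope
-- for the statement of lemma4p5, which uses the natural-number operators.
module _ where

  open import Algebra.Bundles using (CommutativeRing)
  open import Data.Empty using (⊥; ⊥-elim)
  open import Data.Fin as Fin using (Fin; zero; suc; toℕ; fromℕ<; punchIn; punchOut; _↑ˡ_; _↑ʳ_; splitAt)
  open import Data.Fin.Properties
    using (_≟_; any?; <⇒≢; toℕ<n; toℕ-fromℕ<; toℕ-injective; suc-injective; injective⇒≤; punchInᵢ≢i; punchIn-injective;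
           punchOut-injective; punchIn-punchOut; splitAt⁻¹-↑ˡ; splitAt⁻¹-↑ʳ)
  import Data.Integer as ℤ
  import Data.Integer.Properties as ℤP
  open import Data.List using (List; []; _∷_; length; filter; allFin; tabulate; _++_; map; lookup)
  open import Data.List.Membership.Propositional using (_∈_; _∉_; find)
  open import Data.List.Membership.Propositional.Properties
    using (∈-filter⁻; ∈-filter⁺; ∈-allFin; ∈-∃++; ∈-++⁻; ∈-++⁺ˡ; ∈-++⁺ʳ; ∈-tabulate⁺; ∈-lookup; ∈-map⁺)
  open import Data.List.Membership.DecPropositional using (_∈?_)
  open import Data.List.Properties
    using (length-++; length-tabulate; length-map; filter-accept; filter-reject; filter-all; filter-none)
  open import Data.List.Relation.Unary.All as All using (All; []; _∷_)
  open import Data.List.Relation.Unary.All.Properties using (¬All⇒Any¬)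
  open import Data.List.Relation.Unary.Any as Any using (here; there)
  open import Data.List.Relation.Unary.Any.Properties using (lookup-index)
  open import Data.List.Relation.Unary.Unique.Propositional using (Unique; []; _∷_)
  open import Data.List.Relation.Unary.Unique.Propositional.Properties using (allFin⁺; filter⁺)
  open import Data.Nat as ℕ using (ℕ; zero; suc; z≤n; s≤s)
  import Data.Nat.Coprimality as Coprimality
  import Data.Nat.Properties as ℕP
  open import Data.Nat.Solver renaming (module +-*-Solver to ℕ-Solver)
  open import Data.Product using (∃; ∃₂; _×_; _,_; proj₁; proj₂)
  open import Data.Rational as ℚ using (ℚ; mkℚ; 0ℚ; 1ℚ; _+_; _*_; _-_; -_; 1/_; _/_; _≤_)
  open import Data.Rational.Properties as ℚP
    using (+-identityˡ; +-identityʳ; *-identityʳ; *-zeroˡ; *-zeroʳ; *-assoc; *-comm; *-inverseˡ; neg-distrib-+)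
  open import Data.Rational.Solver renaming (module +-*-Solver to ℚ-Solver)
  open import Data.Sum using (inj₁; inj₂)
  import Data.Vec.Functional as Vector
  open import Data.Vec.Functional using (insertAt; removeAt)
  open import Data.Vec.Functional.Properties using (lookup-++ˡ; lookup-++ʳ; insertAt-lookup; insertAt-punchIn)
  open import Function using (_∘_; _∘′_; id; const)
  open import Relation.Binary.Definitions using (DecidableEquality)
  open import Relation.Binary.PropositionalEquality
  open import Relation.Nullary using (¬_; Dec; yes; no)
  open import Relation.Nullary.Decidable using (¬?; _×-dec_; from-yes; from-no; decidable-stable)

  open import Algebra.Properties.Semiring.Sum (CommutativeRing.semiring ℚP.+-*-commutativeRing)
    using (sum; sum-cong-≗; ∑-distrib-+; sum-remove; *-distribˡ-sum; *-distribʳ-sum)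

  private
    variable
      A : Set
      k m n d t : ℕ

  -- Rational arithmetic

  nonneg-+-≡0ˡ : {x y : ℚ} → 0ℚ ≤ x → 0ℚ ≤ y → x + y ≡ 0ℚ → x ≡ 0ℚ
  nonneg-+-≡0ˡ {x} {y} x≥0 y≥0 x+y≡0 = ℚP.≤-antisym x≤0 x≥0
    where
    x≤0 : x ≤ 0ℚ
    x≤0 = begin
      x       ≡⟨ +-identityʳ x ⟨
      x + 0ℚ  ≤⟨ ℚP.+-monoʳ-≤ x y≥0 ⟩
      x + y   ≡⟨ x+y≡0 ⟩
      0ℚ      ∎
      where open ℚP.≤-Reasoning

  *-≡0⇒≡0 : {x y : ℚ} → y ≢ 0ℚ → x * y ≡ 0ℚ → x ≡ 0ℚ
  *-≡0⇒≡0 {x} {y} y≢0 xy≡0 = begin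
    x                 ≡⟨ *-identityʳ x ⟨
    x * 1ℚ            ≡⟨ cong (x *_) (ℚP.*-inverseʳ y) ⟨
    x * (y * 1/ y)    ≡⟨ *-assoc x y (1/ y) ⟨
    x * y * 1/ y      ≡⟨ cong (_* 1/ y) xy≡0 ⟩
    0ℚ * 1/ y         ≡⟨ *-zeroˡ (1/ y) ⟩
    0ℚ                ∎
    where
    open ≡-Reasoning
    instance
      y≢0′ : ℚ.NonZero y
      y≢0′ = ℚ.≢-nonZero y≢0

  square-nonneg : (x : ℚ) → 0ℚ ≤ x * x
  square-nonneg x with ℚP.≤-total 0ℚ x
  ... | inj₁ x≥0 = ℚP.nonNegative⁻¹ _ {{ℚP.nonNeg*nonNeg⇒nonNeg x {{ℚ.nonNegative x≥0}} x {{ℚ.nonNegative x≥0}}}}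
  ... | inj₂ x≤0 = ℚP.nonNegative⁻¹ _ {{ℚP.nonPos*nonPos⇒nonPos x {{ℚ.nonPositive x≤0}} x {{ℚ.nonPositive x≤0}}}}

  square-≡0 : {x : ℚ} → x * x ≡ 0ℚ → x ≡ 0ℚ
  square-≡0 {x} x²≡0 with x ℚP.≟ 0ℚ
  ... | yes x≡0 = x≡0
  ... | no  x≢0 = ⊥-elim (x≢0 (*-≡0⇒≡0 x≢0 x²≡0))

  ℕ→ℚ≡mkℚ : ∀ n → ℕ→ℚ n ≡ mkℚ (ℤ.+ n) 0 (Coprimality.sym (Coprimality.1-coprimeTo n))
  ℕ→ℚ≡mkℚ n = ℚP.normalize-coprime _

  ℕ→ℚ-+ : ∀ a b → ℕ→ℚ (a ℕ.+ b) ≡ ℕ→ℚ a + ℕ→ℚ b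
  ℕ→ℚ-+ a b = sym (begin
    ℕ→ℚ a + ℕ→ℚ b
      ≡⟨ cong₂ _+_ (ℕ→ℚ≡mkℚ a) (ℕ→ℚ≡mkℚ b) ⟩
    (ℤ.+ a ℤ.* ℤ.+ 1 ℤ.+ ℤ.+ b ℤ.* ℤ.+ 1) / 1
      ≡⟨ ℚP./-cong (cong₂ ℤ._+_ (ℤP.*-identityʳ (ℤ.+ a)) (ℤP.*-identityʳ (ℤ.+ b))) refl ⟩
    (ℤ.+ a ℤ.+ ℤ.+ b) / 1
      ≡⟨ ℚP./-cong (sym (ℤP.pos-+ a b)) refl ⟩
    ℕ→ℚ (a ℕ.+ b)
      ∎)
    where open ≡-Reasoning

  ℕ→ℚ-* : ∀ a b → ℕ→ℚ (a ℕ.* b) ≡ ℕ→ℚ a * ℕ→ℚ b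
  ℕ→ℚ-* a b = sym (begin
    ℕ→ℚ a * ℕ→ℚ b          ≡⟨ cong₂ _*_ (ℕ→ℚ≡mkℚ a) (ℕ→ℚ≡mkℚ b) ⟩
    (ℤ.+ a ℤ.* ℤ.+ b) / 1  ≡⟨ ℚP./-cong (sym (ℤP.pos-* a b)) refl ⟩
    ℕ→ℚ (a ℕ.* b)          ∎)
    where open ≡-Reasoning

  ℕ→ℚ-mono-≤ : ∀ {a b} → a ℕ.≤ b → ℕ→ℚ a ≤ ℕ→ℚ b
  ℕ→ℚ-mono-≤ {a} {b} a≤b rewrite ℕ→ℚ≡mkℚ a | ℕ→ℚ≡mkℚ b =
    ℚ.*≤* (subst₂ ℤ._≤_ (sym (ℤP.*-identityʳ (ℤ.+ a))) (sym (ℤP.*-identityʳ (ℤ.+ b))) (ℤ.+≤+ a≤b))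

  ℕ→ℚ-cancel-≤ : ∀ {a b} → ℕ→ℚ a ≤ ℕ→ℚ b → a ℕ.≤ b
  ℕ→ℚ-cancel-≤ {a} {b} a≤b rewrite ℕ→ℚ≡mkℚ a | ℕ→ℚ≡mkℚ b =
    ℤP.drop‿+≤+ (subst₂ ℤ._≤_ (ℤP.*-identityʳ (ℤ.+ a)) (ℤP.*-identityʳ (ℤ.+ b)) (ℚP.drop-*≤* a≤b))

  ℕ→ℚ-nonNeg : ∀ n → ℚ.NonNegative (ℕ→ℚ n)
  ℕ→ℚ-nonNeg n = ℚ.nonNegative (ℕ→ℚ-mono-≤ {0} {n} z≤n)

  standingParams⇒63≤32c : ∀ {ε k₀ c} → StandingParams ε k₀ c → ℕ→ℚ 63 ≤ ℕ→ℚ 32 * c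
  standingParams⇒63≤32c {ε} {k₀} {c} (0<ε , ε≤ , _ , c≥ , _ , _) = begin
    ℕ→ℚ 63                                    ≡⟨ refl ⟩
    ℕ→ℚ 32 * (ℕ→ℚ 2 - 1ℚ * (ℤ.+ 1 / 32))      ≤⟨ ℚP.*-monoˡ-≤-nonNeg (ℕ→ℚ 32) (ℚP.+-monoʳ-≤ (ℕ→ℚ 2) -1/32≤-ε²/32) ⟩
    ℕ→ℚ 32 * (ℕ→ℚ 2 - ε * ε * (ℤ.+ 1 / 32))  ≤⟨ ℚP.*-monoˡ-≤-nonNeg (ℕ→ℚ 32) c≥ ⟩
    ℕ→ℚ 32 * c                                ∎
    where
    open ℚP.≤-Reasoning
    ε≤1 : ε ≤ 1ℚ
    ε≤1 = ℚP.≤-trans ε≤ (from-yes (ℤ.+ 1 / 4096 ℚP.≤? 1ℚ))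
    ε²≤1 : ε * ε ≤ 1ℚ
    ε²≤1 = begin
      ε * ε   ≤⟨ ℚP.*-monoˡ-≤-nonNeg ε {{ℚ.nonNegative (ℚP.<⇒≤ 0<ε)}} ε≤1 ⟩
      ε * 1ℚ  ≡⟨ *-identityʳ ε ⟩
      ε       ≤⟨ ε≤1 ⟩
      1ℚ      ∎
    -1/32≤-ε²/32 : - (1ℚ * (ℤ.+ 1 / 32)) ≤ - (ε * ε * (ℤ.+ 1 / 32))
    -1/32≤-ε²/32 = ℚP.neg-antimono-≤ (ℚP.*-monoʳ-≤-nonNeg (ℤ.+ 1 / 32) ε²≤1)

  -- Finite sums

  sumFin≡sum : (f : Fin n → ℚ) → sumFin f ≡ sum f
  sumFin≡sum {zero}  f = refl
  sumFin≡sum {suc n} f = cong (f zero +_) (sumFin≡sum (f ∘ suc))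

  sumFin-cong : {f g : Fin n → ℚ} → f ≗ g → sumFin f ≡ sumFin g
  sumFin-cong {f = f} {g} f≗g rewrite sumFin≡sum f | sumFin≡sum g = sum-cong-≗ f≗g

  sumFin-zero : {f : Fin n → ℚ} → (∀ i → f i ≡ 0ℚ) → sumFin f ≡ 0ℚ
  sumFin-zero {zero}  f≡0 = refl
  sumFin-zero {suc n} f≡0 = cong₂ _+_ (f≡0 zero) (sumFin-zero (f≡0 ∘ suc))

  sumFin-+ : (f g : Fin n → ℚ) → sumFin (λ i → f i + g i) ≡ sumFin f + sumFin g
  sumFin-+ f g rewrite sumFin≡sum f | sumFin≡sum g | sumFin≡sum (λ i → f i + g i) = ∑-distrib-+ f g

  sumFin-neg : (f : Fin n → ℚ) → sumFin (λ i → - f i) ≡ - sumFin f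
  sumFin-neg {zero}  f = refl
  sumFin-neg {suc n} f = trans (cong (- f zero +_) (sumFin-neg (f ∘ suc))) (sym (neg-distrib-+ (f zero) (sumFin (f ∘ suc))))

  sumFin-- : (f g : Fin n → ℚ) → sumFin (λ i → f i - g i) ≡ sumFin f - sumFin g
  sumFin-- f g = trans (sumFin-+ f (λ i → - g i)) (cong (sumFin f +_) (sumFin-neg g))

  sumFin-*ˡ : (c : ℚ) (f : Fin n → ℚ) → sumFin (λ i → c * f i) ≡ c * sumFin f
  sumFin-*ˡ c f rewrite sumFin≡sum f | sumFin≡sum (λ i → c * f i) = sym (*-distribˡ-sum c f)

  sumFin-*ʳ : (c : ℚ) (f : Fin n → ℚ) → sumFin (λ i → f i * c) ≡ sumFin f * c
  sumFin-*ʳ c f rewrite sumFin≡sum f | sumFin≡sum (λ i → f i * c) = sym (*-distribʳ-sum c f)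

  sumFin-comm : (f : Fin m → Fin n → ℚ) →
    sumFin (λ i → sumFin (f i)) ≡ sumFin (λ j → sumFin (λ i → f i j))
  sumFin-comm {zero} {n} f = sym (sumFin-zero {n} (λ _ → refl))
  sumFin-comm {suc m} f =
    trans (cong (sumFin (f zero) +_) (sumFin-comm (f ∘ suc))) (sym (sumFin-+ (f zero) _))

  sumFin-removeAt : (f : Fin (suc n) → ℚ) (i : Fin (suc n)) → sumFin f ≡ f i + sumFin (removeAt f i)
  sumFin-removeAt f i rewrite sumFin≡sum f | sumFin≡sum (removeAt f i) = sum-remove f

  sumFin-single : {f : Fin n → ℚ} (i : Fin n) → (∀ j → j ≢ i → f j ≡ 0ℚ) → sumFin f ≡ f i
  sumFin-single {suc n} {f} i others≡0 = begin
    sumFin f                       ≡⟨ sumFin-removeAt f i ⟩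
    f i + sumFin (removeAt f i)    ≡⟨ cong (f i +_) (sumFin-zero (λ j → others≡0 _ (punchInᵢ≢i i j))) ⟩
    f i + 0ℚ                       ≡⟨ +-identityʳ (f i) ⟩
    f i                            ∎
    where open ≡-Reasoning

  sumFin-↑ˡ-↑ʳ : (f : Fin (m ℕ.+ n) → ℚ) → sumFin f ≡ sumFin (λ i → f (i ↑ˡ n)) + sumFin (λ i → f (m ↑ʳ i))
  sumFin-↑ˡ-↑ʳ {zero}  f = sym (+-identityˡ _)
  sumFin-↑ˡ-↑ʳ {suc m} {n} f =
    trans (cong (f zero +_) (sumFin-↑ˡ-↑ʳ {m} {n} (f ∘ suc))) (sym (ℚP.+-assoc (f zero) _ _))

  sumFin-nonneg : {f : Fin n → ℚ} → (∀ i → 0ℚ ≤ f i) → 0ℚ ≤ sumFin f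
  sumFin-nonneg {zero}  _ = ℚP.≤-refl
  sumFin-nonneg {suc n} f≥0 = ℚP.+-mono-≤ (f≥0 zero) (sumFin-nonneg (f≥0 ∘ suc))

  sumFin-nonneg-≡0 : {f : Fin n → ℚ} → (∀ i → 0ℚ ≤ f i) → sumFin f ≡ 0ℚ → ∀ i → f i ≡ 0ℚ
  sumFin-nonneg-≡0 {suc n} {f} f≥0 Σ≡0 zero    = nonneg-+-≡0ˡ (f≥0 zero) (sumFin-nonneg (f≥0 ∘ suc)) Σ≡0
  sumFin-nonneg-≡0 {suc n} {f} f≥0 Σ≡0 (suc i) = sumFin-nonneg-≡0 (f≥0 ∘ suc) rest≡0 i
    where
    rest≡0 : sumFin (f ∘ suc) ≡ 0ℚ
    rest≡0 = begin
      sumFin (f ∘ suc)        ≡⟨ +-identityˡ _ ⟨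
      0ℚ + sumFin (f ∘ suc)   ≡⟨ cong (_+ sumFin (f ∘ suc)) (sumFin-nonneg-≡0 f≥0 Σ≡0 zero) ⟨
      sumFin f                ≡⟨ Σ≡0 ⟩
      0ℚ                      ∎
      where open ≡-Reasoning

  sumFin≢0⇒∃≢0 : (f : Fin n → ℚ) → sumFin f ≢ 0ℚ → ∃ λ i → f i ≢ 0ℚ
  sumFin≢0⇒∃≢0 f Σ≢0 with any? (λ i → ¬? (f i ℚP.≟ 0ℚ))
  ... | yes found = found
  ... | no  none  = ⊥-elim (Σ≢0 (sumFin-zero (λ i → decidable-stable (f i ℚP.≟ 0ℚ) (λ ≢0 → none (i , ≢0)))))

  -- Linear algebra over ℚ

  unit-diag : (i : Fin k) → unit i i ≡ 1ℚ
  unit-diag i with i ≟ i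
  ... | yes _   = refl
  ... | no  i≢i = ⊥-elim (i≢i refl)

  unit-off : {i j : Fin k} → i ≢ j → unit i j ≡ 0ℚ
  unit-off {i = i} {j} i≢j with i ≟ j
  ... | yes i≡j = ⊥-elim (i≢j i≡j)
  ... | no  _   = refl

  content-value : ∀ (i₁ i₂ i₃ i₄ : Fin k) {u : Fin k} {p q r s : ℚ} →
    unit i₁ u ≡ p → unit i₂ u ≡ q → unit i₃ u ≡ r → unit i₄ u ≡ s →
    content (i₁ , i₂ , i₃ , i₄) u ≡ ((p - q) - r) + s
  content-value _ _ _ _ refl refl refl refl = refl

  content-support : ∀ {i₁ i₂ i₃ i₄ u : Fin k} {L : List (Fin k)} →
    i₁ ∈ L → i₂ ∈ L → i₃ ∈ L → i₄ ∈ L → content (i₁ , i₂ , i₃ , i₄) u ≢ 0ℚ → u ∈ L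
  content-support {i₁ = i₁} {i₂} {i₃} {i₄} {u} {L} ∈₁ ∈₂ ∈₃ ∈₄ ≢0 =
    decide (i₁ ≟ u) (i₂ ≟ u) (i₃ ≟ u) (i₄ ≟ u)
    where
    decide : Dec (i₁ ≡ u) → Dec (i₂ ≡ u) → Dec (i₃ ≡ u) → Dec (i₄ ≡ u) → u ∈ L
    decide (yes e) _       _       _       = subst (_∈ L) e ∈₁
    decide (no _)  (yes e) _       _       = subst (_∈ L) e ∈₂
    decide (no _)  (no _)  (yes e) _       = subst (_∈ L) e ∈₃
    decide (no _)  (no _)  (no _)  (yes e) = subst (_∈ L) e ∈₄
    decide (no ≢₁) (no ≢₂) (no ≢₃) (no ≢₄) =
      ⊥-elim (≢0 (content-value i₁ i₂ i₃ i₄ (unit-off ≢₁) (unit-off ≢₂) (unit-off ≢₃) (unit-off ≢₄)))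

  lincomb-lincomb : (u : Fin m → Vecℚ k) (ν : Fin n → Fin m → ℚ) (μ : Fin n → ℚ) (x : Fin k) →
    lincomb (λ j → lincomb u (ν j)) μ x ≡ lincomb u (λ l → sumFin (λ j → μ j * ν j l)) x
  lincomb-lincomb u ν μ x = begin
    sumFin (λ j → μ j * sumFin (λ l → ν j l * u l x))
      ≡⟨ sumFin-cong (λ j → sumFin-*ˡ (μ j) (λ l → ν j l * u l x)) ⟨
    sumFin (λ j → sumFin (λ l → μ j * (ν j l * u l x)))
      ≡⟨ sumFin-comm (λ j l → μ j * (ν j l * u l x)) ⟩
    sumFin (λ l → sumFin (λ j → μ j * (ν j l * u l x)))
      ≡⟨ sumFin-cong (λ l → trans (sumFin-cong (λ j → sym (*-assoc (μ j) _ _))) (sumFin-*ʳ (u l x) (λ j → μ j * ν j l))) ⟩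
    sumFin (λ l → sumFin (λ j → μ j * ν j l) * u l x)
      ∎
    where open ≡-Reasoning

  lincomb-insertAt : (w : Fin (suc n) → Vecℚ k) (μ : Fin n → ℚ) (j : Fin (suc n)) (a : ℚ) (x : Fin k) →
    lincomb w (insertAt μ j a) x ≡ a * w j x + lincomb (removeAt w j) μ x
  lincomb-insertAt w μ j a x = trans (sumFin-removeAt (λ i → insertAt μ j a i * w i x) j) (cong₂ _+_
    (cong (_* w j x) (insertAt-lookup μ j a))
    (sumFin-cong (λ i → cong (_* w (punchIn j i) x) (insertAt-punchIn μ j a i))))

  lincomb-++ : (F : Fin n → Vecℚ k) (B : Fin d → Vecℚ k) (μ : Fin (n ℕ.+ d) → ℚ) (x : Fin k) →
    lincomb (F Vector.++ B) μ x ≡ lincomb F (μ ∘ (_↑ˡ d)) x + lincomb B (μ ∘ (n ↑ʳ_)) x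
  lincomb-++ {n = n} {d = d} F B μ x = trans (sumFin-↑ˡ-↑ʳ {n} {d} _) (cong₂ _+_
    (sumFin-cong (λ i → cong (λ v → μ (i ↑ˡ d) * v x) (lookup-++ˡ F B i)))
    (sumFin-cong (λ i → cong (λ v → μ (n ↑ʳ i) * v x) (lookup-++ʳ F B i))))

  dot-comm : (u x : Vecℚ k) → dot u x ≡ dot x u
  dot-comm u x = sumFin-cong (λ i → *-comm (u i) (x i))

  dot-⊕ˡ : (u v x : Vecℚ k) → dot (u ⊕ v) x ≡ dot u x + dot v x
  dot-⊕ˡ u v x = trans (sumFin-cong (λ i → ℚP.*-distribʳ-+ (x i) (u i) (v i))) (sumFin-+ (λ i → u i * x i) (λ i → v i * x i))

  dot-lincombˡ : (w : Fin n → Vecℚ k) (μ : Fin n → ℚ) (x : Vecℚ k) →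
    dot (lincomb w μ) x ≡ sumFin (λ j → μ j * dot (w j) x)
  dot-lincombˡ w μ x = begin
    sumFin (λ i → sumFin (λ j → μ j * w j i) * x i)
      ≡⟨ sumFin-cong (λ i → sumFin-*ʳ (x i) (λ j → μ j * w j i)) ⟨
    sumFin (λ i → sumFin (λ j → μ j * w j i * x i))
      ≡⟨ sumFin-comm (λ i j → μ j * w j i * x i) ⟩
    sumFin (λ j → sumFin (λ i → μ j * w j i * x i))
      ≡⟨ sumFin-cong (λ j → trans (sumFin-cong (λ i → *-assoc (μ j) (w j i) (x i))) (sumFin-*ˡ (μ j) (λ i → w j i * x i))) ⟩
    sumFin (λ j → μ j * dot (w j) x)
      ∎
    where open ≡-Reasoning

  dot-lincombʳ : (u : Vecℚ k) (w : Fin n → Vecℚ k) (μ : Fin n → ℚ) →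
    dot u (lincomb w μ) ≡ sumFin (λ j → μ j * dot u (w j))
  dot-lincombʳ u w μ = trans (dot-comm u _) (trans (dot-lincombˡ w μ u)
    (sumFin-cong (λ j → cong (μ j *_) (dot-comm (w j) u))))

  dot-self≡0 : (y : Vecℚ k) → dot y y ≡ 0ℚ → ∀ i → y i ≡ 0ℚ
  dot-self≡0 y y·y≡0 i = square-≡0 (sumFin-nonneg-≡0 (λ i → square-nonneg (y i)) y·y≡0 i)

  Implies-cong : (C : Config k m) {u v : Vecℚ k} → u ≗ v → Implies C v → Implies C u
  Implies-cong C u≗v (μ , v≗) = μ , (λ i → trans (u≗v i) (v≗ i))

  Implies-lincomb : (C : Config k m) (w : Fin n → Vecℚ k) (μ : Fin n → ℚ) →
    (∀ j → Implies C (w j)) → Implies C (lincomb w μ)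
  Implies-lincomb C w μ w-imp = (λ l → sumFin (λ j → μ j * proj₁ (w-imp j) l)) , λ x → trans
    (sumFin-cong (λ j → cong (μ j *_) (proj₂ (w-imp j) x)))
    (lincomb-lincomb (λ l → content (C l)) (λ j → proj₁ (w-imp j)) μ x)

  Solution-lincomb : (C : Config k m) (B : Fin d → Vecℚ k) (β : Fin d → ℚ) →
    (∀ j → Solution C (B j)) → Solution C (lincomb B β)
  Solution-lincomb C B β B-sol l = trans (dot-lincombʳ (content (C l)) B β)
    (sumFin-zero (λ j → trans (cong (β j *_) (B-sol j l)) (*-zeroʳ (β j))))

  implied·solution≡0 : (C : Config k m) {v x : Vecℚ k} → Implies C v → Solution C x → dot v x ≡ 0ℚ
  implied·solution≡0 C {v} {x} (μ , v≗) x-sol = begin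
    dot v x                                            ≡⟨ sumFin-cong (λ i → cong (_* x i) (v≗ i)) ⟩
    dot (lincomb (λ j → content (C j)) μ) x            ≡⟨ dot-lincombˡ _ μ x ⟩
    sumFin (λ j → μ j * dot (content (C j)) x)         ≡⟨ sumFin-zero (λ j → trans (cong (μ j *_) (x-sol j)) (*-zeroʳ (μ j))) ⟩
    0ℚ                                                 ∎
    where open ≡-Reasoning

  Independent-∷ : (g : Vecℚ k) (F : Fin n → Vecℚ k) (α : Fin k) →
    g α ≢ 0ℚ → (∀ i → F i α ≡ 0ℚ) → Independent F → Independent (g Vector.∷ F)
  Independent-∷ g F α gα≢0 Fα≡0 F-ind μ dep = coefficients
    where
    μ₀≡0 : μ zero ≡ 0ℚ
    μ₀≡0 = *-≡0⇒≡0 gα≢0 (begin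
      μ zero * g α                          ≡⟨ +-identityʳ _ ⟨
      μ zero * g α + 0ℚ                     ≡⟨ cong (μ zero * g α +_) (sumFin-zero rest≡0) ⟨
      μ zero * g α + lincomb F (μ ∘ suc) α  ≡⟨ dep α ⟩
      0ℚ                                    ∎)
      where
      open ≡-Reasoning
      rest≡0 : ∀ i → μ (suc i) * F i α ≡ 0ℚ
      rest≡0 i = trans (cong (μ (suc i) *_) (Fα≡0 i)) (*-zeroʳ (μ (suc i)))
    coefficients : ∀ i → μ i ≡ 0ℚ
    coefficients zero    = μ₀≡0
    coefficients (suc i) = F-ind (μ ∘ suc) (λ x → begin
      lincomb F (μ ∘ suc) x                 ≡⟨ +-identityˡ _ ⟨
      0ℚ + lincomb F (μ ∘ suc) x            ≡⟨ cong (_+ lincomb F (μ ∘ suc) x) (trans (cong (_* g x) μ₀≡0) (*-zeroˡ (g x))) ⟨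
      μ zero * g x + lincomb F (μ ∘ suc) x  ≡⟨ dep x ⟩
      0ℚ                                    ∎) i
      where open ≡-Reasoning

  halves-≡0 : {μ : Fin (n ℕ.+ d) → ℚ} → (∀ i → μ (i ↑ˡ d) ≡ 0ℚ) → (∀ j → μ (n ↑ʳ j) ≡ 0ℚ) → ∀ l → μ l ≡ 0ℚ
  halves-≡0 {n} {d} {μ} left≡0 right≡0 l with splitAt n l in eq
  ... | inj₁ i = subst (λ l → μ l ≡ 0ℚ) (splitAt⁻¹-↑ˡ eq) (left≡0 i)
  ... | inj₂ j = subst (λ l → μ l ≡ 0ℚ) (splitAt⁻¹-↑ʳ eq) (right≡0 j)

  Independent-removeAt : (w : Fin (suc n) → Vecℚ k) (i : Fin (suc n)) → Independent (removeAt w i) →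
    ∀ μ → (∀ x → lincomb w μ x ≡ 0ℚ) → μ i ≡ 0ℚ → ∀ j → μ j ≡ 0ℚ
  Independent-removeAt w i rest-ind μ dep μi≡0 j with i ≟ j
  ... | yes refl = μi≡0
  ... | no  i≢j  = trans (cong μ (sym (punchIn-punchOut i≢j))) (rest-ind (removeAt μ i) rest-dep (punchOut i≢j))
    where
    rest-dep : ∀ x → lincomb (removeAt w i) (removeAt μ i) x ≡ 0ℚ
    rest-dep x = begin
      rest                ≡⟨ +-identityˡ _ ⟨
      0ℚ + rest           ≡⟨ cong (_+ rest) (trans (cong (_* w i x) μi≡0) (*-zeroˡ (w i x))) ⟨
      μ i * w i x + rest  ≡⟨ sumFin-removeAt (λ j → μ j * w j x) i ⟨
      lincomb w μ x       ≡⟨ dep x ⟩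
      0ℚ                  ∎
      where
      open ≡-Reasoning
      rest = lincomb (removeAt w i) (removeAt μ i) x

  lincomb≡0-isolated : (w : Fin n → Vecℚ k) (μ : Fin n → ℚ) → (∀ x → lincomb w μ x ≡ 0ℚ) →
    ∀ i v → w i v ≢ 0ℚ → (∀ j → j ≢ i → w j v ≡ 0ℚ) → μ i ≡ 0ℚ
  lincomb≡0-isolated w μ dep i v wiv≢0 others≡0 = *-≡0⇒≡0 wiv≢0 (trans
    (sym (sumFin-single i (λ j j≢i → trans (cong (μ j *_) (others≡0 j j≢i)) (*-zeroʳ (μ j)))))
    (dep v))

  lincomb≡0-shared : (w : Fin n → Vecℚ k) (μ : Fin n → ℚ) → (∀ x → lincomb w μ x ≡ 0ℚ) → (∀ i → μ i ≢ 0ℚ) →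
    ∀ i v → w i v ≢ 0ℚ → ∃ λ j → j ≢ i × w j v ≢ 0ℚ
  lincomb≡0-shared w μ dep μ≢0 i v wiv≢0 with any? (λ j → ¬? (j ≟ i) ×-dec ¬? (w j v ℚP.≟ 0ℚ))
  ... | yes found = found
  ... | no  none  = ⊥-elim (μ≢0 i (lincomb≡0-isolated w μ dep i v wiv≢0 others≡0))
    where
    others≡0 : ∀ j → j ≢ i → w j v ≡ 0ℚ
    others≡0 j j≢i = decidable-stable (w j v ℚP.≟ 0ℚ) (λ ≢0 → none (j , j≢i , ≢0))

  Independent-eliminate : (w : Fin (suc n) → Vecℚ k) (j : Fin (suc n)) (c : Fin n → ℚ) →
    Independent w → Independent (λ i x → w (punchIn j i) x - c i * w j x)
  Independent-eliminate w j c w-ind μ dep i =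
    trans (sym (insertAt-punchIn μ j a i)) (w-ind (insertAt μ j a) lifted (punchIn j i))
    where
    open ℚ-Solver
    a = - sumFin (λ i → μ i * c i)
    lifted : ∀ x → lincomb w (insertAt μ j a) x ≡ 0ℚ
    lifted x = begin
      lincomb w (insertAt μ j a) x
        ≡⟨ lincomb-insertAt w μ j a x ⟩
      a * w j x + sumFin (λ i → μ i * w (punchIn j i) x)
        ≡⟨ solve 3 (λ S W L → (:- S) :* W :+ L := L :- S :* W) refl (sumFin (λ i → μ i * c i)) (w j x) _ ⟩
      sumFin (λ i → μ i * w (punchIn j i) x) - sumFin (λ i → μ i * c i) * w j x
        ≡⟨ cong (λ t → sumFin (λ i → μ i * w (punchIn j i) x) - t) (sumFin-*ʳ (w j x) (λ i → μ i * c i)) ⟨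
      sumFin (λ i → μ i * w (punchIn j i) x) - sumFin (λ i → μ i * c i * w j x)
        ≡⟨ sumFin-- (λ i → μ i * w (punchIn j i) x) (λ i → μ i * c i * w j x) ⟨
      sumFin (λ i → μ i * w (punchIn j i) x - μ i * c i * w j x)
        ≡⟨ sumFin-cong (λ i → solve 4 (λ m A C W → m :* A :- m :* C :* W := m :* (A :- C :* W)) refl (μ i) _ (c i) (w j x)) ⟩
      lincomb (λ i x → w (punchIn j i) x - c i * w j x) μ x
        ≡⟨ dep x ⟩
      0ℚ
        ∎
      where open ≡-Reasoning

  Independent-tail : (w : Fin n → Vecℚ (suc k)) → (∀ i → w i zero ≡ 0ℚ) →
    Independent w → Independent (λ i x → w i (suc x))
  Independent-tail w w₀≡0 w-ind μ dep = w-ind μ full-dep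
    where
    full-dep : ∀ x → lincomb w μ x ≡ 0ℚ
    full-dep zero    = sumFin-zero (λ i → trans (cong (μ i *_) (w₀≡0 i)) (*-zeroʳ (μ i)))
    full-dep (suc x) = dep x

  Independent⇒≤ : (w : Fin n → Vecℚ k) → Independent w → n ℕ.≤ k
  Independent⇒≤ {zero}          w _     = z≤n
  Independent⇒≤ {suc n} {zero}  w w-ind = ⊥-elim (ℚP.1≢0 (w-ind (const 1ℚ) (λ ()) zero))
  Independent⇒≤ {suc n} {suc k} w w-ind with any? (λ j → ¬? (w j zero ℚP.≟ 0ℚ))
  ... | no  no-pivot      = ℕP.m≤n⇒m≤1+n (Independent⇒≤ (λ i x → w i (suc x)) (Independent-tail w column₀≡0 w-ind))
    where
    column₀≡0 : ∀ j → w j zero ≡ 0ℚ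
    column₀≡0 j = decidable-stable (w j zero ℚP.≟ 0ℚ) (λ ≢0 → no-pivot (j , ≢0))
  ... | yes (j , pivot≢0) = s≤s (Independent⇒≤ _ (Independent-tail reduced reduced₀≡0 reduced-ind))
    where
    instance
      pivot-nonZero : ℚ.NonZero (w j zero)
      pivot-nonZero = ℚ.≢-nonZero pivot≢0
    c : Fin n → ℚ
    c i = w (punchIn j i) zero * 1/ (w j zero)
    reduced : Fin n → Vecℚ (suc k)
    reduced i x = w (punchIn j i) x - c i * w j x
    reduced-ind : Independent reduced
    reduced-ind = Independent-eliminate w j c w-ind
    reduced₀≡0 : ∀ i → reduced i zero ≡ 0ℚ
    reduced₀≡0 i = begin
      q - q * 1/ p * p     ≡⟨ cong (λ t → q - t) (*-assoc q (1/ p) p) ⟩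
      q - q * (1/ p * p)   ≡⟨ cong (λ t → q - q * t) (*-inverseˡ p) ⟩
      q - q * 1ℚ           ≡⟨ cong (λ t → q - t) (*-identityʳ q) ⟩
      q - q                ≡⟨ ℚP.+-inverseʳ q ⟩
      0ℚ                   ∎
      where
      open ≡-Reasoning
      q = w (punchIn j i) zero
      p = w j zero

  implied+solutions⇒≤ : (C : Config k m) (F : Fin n → Vecℚ k) (B : Fin d → Vecℚ k) →
    (∀ i → Implies C (F i)) → Independent F → (∀ j → Solution C (B j)) → Independent B → n ℕ.+ d ℕ.≤ k
  implied+solutions⇒≤ {n = n} {d = d} C F B F-imp F-ind B-sol B-ind = Independent⇒≤ (F Vector.++ B) F++B-ind
    where
    F++B-ind : Independent (F Vector.++ B)
    F++B-ind μ dep = halves-≡0 (F-ind α u≡0) (B-ind β y≡0)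
      where
      α = μ ∘ (_↑ˡ d)
      β = μ ∘ (n ↑ʳ_)
      u = lincomb F α
      y = lincomb B β
      u+y≡0 : ∀ x → (u ⊕ y) x ≡ 0ℚ
      u+y≡0 x = trans (sym (lincomb-++ F B μ x)) (dep x)
      -- u is implied and y is a solution, so u · y = 0; as u + y = 0 this forces y · y = 0.
      y·y≡0 : dot y y ≡ 0ℚ
      y·y≡0 = begin
        dot y y             ≡⟨ +-identityˡ _ ⟨
        0ℚ + dot y y        ≡⟨ cong (_+ dot y y) (implied·solution≡0 C (Implies-lincomb C F α F-imp) (Solution-lincomb C B β B-sol)) ⟨
        dot u y + dot y y   ≡⟨ dot-⊕ˡ u y y ⟨
        dot (u ⊕ y) y       ≡⟨ sumFin-zero (λ i → trans (cong (_* y i) (u+y≡0 i)) (*-zeroˡ (y i))) ⟩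
        0ℚ                  ∎
        where open ≡-Reasoning
      y≡0 : ∀ x → y x ≡ 0ℚ
      y≡0 = dot-self≡0 y y·y≡0
      u≡0 : ∀ x → u x ≡ 0ℚ
      u≡0 x = trans (sym (+-identityʳ (u x))) (trans (cong (u x +_) (sym (y≡0 x))) (u+y≡0 x))

  -- Counting

  Unique-⊆⇒length≤ : {xs ys : List A} → Unique xs → (∀ {x} → x ∈ xs → x ∈ ys) → length xs ℕ.≤ length ys
  Unique-⊆⇒length≤ {xs = []}              _             _    = z≤n
  Unique-⊆⇒length≤ {xs = x ∷ xs} {ys} (x∉xs ∷ xs!) xs⊆ys with ∈-∃++ (xs⊆ys (here refl))
  ... | ys₁ , ys₂ , refl = begin
    suc (length xs)                  ≤⟨ s≤s (Unique-⊆⇒length≤ xs! xs⊆ys₁++ys₂) ⟩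
    suc (length (ys₁ ++ ys₂))        ≡⟨ cong suc (length-++ ys₁) ⟩
    suc (length ys₁ ℕ.+ length ys₂)  ≡⟨ ℕP.+-suc (length ys₁) (length ys₂) ⟨
    length ys₁ ℕ.+ suc (length ys₂)  ≡⟨ length-++ ys₁ ⟨
    length (ys₁ ++ x ∷ ys₂)          ∎
    where
    open ℕP.≤-Reasoning
    xs⊆ys₁++ys₂ : ∀ {y} → y ∈ xs → y ∈ ys₁ ++ ys₂
    xs⊆ys₁++ys₂ {y} y∈xs with ∈-++⁻ ys₁ (xs⊆ys (there y∈xs))
    ... | inj₁ y∈ys₁             = ∈-++⁺ˡ y∈ys₁
    ... | inj₂ (here refl)       = ⊥-elim (All.lookup x∉xs y∈xs refl)
    ... | inj₂ (there y∈ys₂)     = ∈-++⁺ʳ ys₁ y∈ys₂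

  varCount≤length : (w : Fin t → Vecℚ k) (L : List (Fin k)) →
    (∀ u → (∃ λ j → w j u ≢ 0ℚ) → u ∈ L) → varCount w ℕ.≤ length L
  varCount≤length {k = k} w L support⊆L = Unique-⊆⇒length≤ (filter⁺ _ (allFin⁺ k))
    (λ {u} u∈ → support⊆L u (proj₂ (∈-filter⁻ (λ u → any? (λ j → ¬? (w j u ℚP.≟ 0ℚ))) {xs = allFin k} u∈)))

  Fin-injective⇒surjective : (f : Fin n → Fin n) → (∀ {i j} → f i ≡ f j → i ≡ j) → ∀ j → ∃ λ i → f i ≡ j
  Fin-injective⇒surjective {suc n} f f-inj j with any? (λ i → f i ≟ j)
  ... | yes found  = found
  ... | no  missed = ⊥-elim (ℕP.<-irrefl refl (injective⇒≤ squeezed-injective))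
    where
    fi≢j : ∀ i → j ≢ f i
    fi≢j i j≡fi = missed (i , sym j≡fi)
    squeezed : Fin (suc n) → Fin n
    squeezed i = punchOut (fi≢j i)
    squeezed-injective : ∀ {i i′} → squeezed i ≡ squeezed i′ → i ≡ i′
    squeezed-injective {i} {i′} eq = f-inj (punchOut-injective (fi≢j i) (fi≢j i′) eq)

  image : (Fin n → Fin k) → List (Fin k)
  image {k = k} y = filter (λ v → any? (λ i → y i ≟ v)) (allFin k)

  image-Unique : (y : Fin n → Fin k) → Unique (image y)
  image-Unique {k = k} y = filter⁺ _ (allFin⁺ k)

  ∈-image⁺ : (y : Fin n → Fin k) (i : Fin n) → y i ∈ image y
  ∈-image⁺ y i = ∈-filter⁺ (λ v → any? (λ i → y i ≟ v)) (∈-allFin (y i)) (i , refl)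

  ∈-image⁻ : (y : Fin n → Fin k) {v : Fin k} → v ∈ image y → ∃ λ i → y i ≡ v
  ∈-image⁻ {k = k} y v∈ = proj₂ (∈-filter⁻ (λ v → any? (λ i → y i ≟ v)) {xs = allFin k} v∈)

  TwoPreimages : (Fin n → A) → A → Set
  TwoPreimages y v = ∃₂ λ i i′ → i ≢ i′ × y i ≡ v × y i′ ≡ v

  twoPreimages⇒≤ : (y : Fin n → A) (R : List A) → Unique R → All (TwoPreimages y) R →
    2 ℕ.* length R ℕ.≤ n
  twoPreimages⇒≤ {n = n} y R R! R-twice with preimages R R! R-twice
    where
    preimages : (R : List _) → Unique R → All (TwoPreimages y) R →
      ∃ λ L → Unique L × length L ≡ 2 ℕ.* length R × (∀ {j} → j ∈ L → y j ∈ R)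
    preimages []      []          []        = [] , [] , refl , λ ()
    preimages (v ∷ R) (v∉R ∷ R!) ((i , i′ , i≢i′ , yi≡v , yi′≡v) ∷ R-twice)
      with preimages R R! R-twice
    ... | L , L! , |L|≡2|R| , L↦R =
      i ∷ i′ ∷ L , (i≢i′ ∷ All.tabulate (∉L yi≡v)) ∷ All.tabulate (∉L yi′≡v) ∷ L! , |ii′L| , iiL↦vR
      where
      ∉L : ∀ {j} → y j ≡ v → ∀ {l} → l ∈ L → j ≢ l
      ∉L yj≡v l∈L refl = All.lookup v∉R (L↦R l∈L) (sym yj≡v)
      |ii′L| : suc (suc (length L)) ≡ 2 ℕ.* suc (length R)
      |ii′L| = cong suc (trans (cong suc |L|≡2|R|) (sym (ℕP.+-suc (length R) (length R ℕ.+ 0))))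
      iiL↦vR : ∀ {j} → j ∈ i ∷ i′ ∷ L → y j ∈ v ∷ R
      iiL↦vR (here refl)         = here yi≡v
      iiL↦vR (there (here refl)) = here yi′≡v
      iiL↦vR (there (there j∈L)) = there (L↦R j∈L)
  ... | L , L! , |L|≡2|R| , _ = begin
    2 ℕ.* length R      ≡⟨ |L|≡2|R| ⟨
    length L            ≤⟨ Unique-⊆⇒length≤ L! (λ {j} _ → ∈-allFin j) ⟩
    length (allFin n)   ≡⟨ length-tabulate (λ i → i) ⟩
    n                   ∎
    where open ℕP.≤-Reasoning

  repeated⇒2|image|≤n : (y : Fin n → Fin k) → (∀ i → ∃ λ i′ → i′ ≢ i × y i′ ≡ y i) → 2 ℕ.* length (image y) ℕ.≤ n
  repeated⇒2|image|≤n y repeated = twoPreimages⇒≤ y (image y) (image-Unique y) (All.tabulate twice)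
    where
    twice : ∀ {v} → v ∈ image y → TwoPreimages y v
    twice v∈ with ∈-image⁻ y v∈
    ... | i , yi≡v with repeated i
    ... | i′ , i′≢i , yi′≡yi = i , i′ , (λ i≡i′ → i′≢i (sym i≡i′)) , yi≡v , trans yi′≡yi yi≡v

  length-filter-≤ : (key : A → ℕ) (n : ℕ) (xs : List A) →
    length (filter (λ x → n ℕ.≤? key x) xs) ≡
    length (filter (λ x → suc n ℕ.≤? key x) xs) ℕ.+ length (filter (λ x → key x ℕ.≟ n) xs)
  length-filter-≤ key n [] = refl
  length-filter-≤ key n (x ∷ xs) = split (n ℕ.≤? key x) (suc n ℕ.≤? key x) (key x ℕ.≟ n)
    where
    ≤? = λ y → n ℕ.≤? key y
    <? = λ y → suc n ℕ.≤? key y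
    ≡? = λ y → key y ℕ.≟ n
    IH = length-filter-≤ key n xs
    split : Dec (n ℕ.≤ key x) → Dec (suc n ℕ.≤ key x) → Dec (key x ≡ n) →
      length (filter ≤? (x ∷ xs)) ≡ length (filter <? (x ∷ xs)) ℕ.+ length (filter ≡? (x ∷ xs))
    split _         (yes n<x) (yes x≡n) = ⊥-elim (ℕP.<⇒≢ n<x (sym x≡n))
    split (yes n≤x) (yes n<x) (no x≢n)  = trans (cong length (filter-accept ≤? n≤x)) (trans (cong suc IH)
      (sym (cong₂ ℕ._+_ (cong length (filter-accept <? n<x)) (cong length (filter-reject ≡? x≢n)))))
    split (yes n≤x) (no n≮x)  (yes x≡n) = trans (cong length (filter-accept ≤? n≤x)) (trans (cong suc IH)
      (trans (sym (ℕP.+-suc _ _)) (sym (cong₂ ℕ._+_ (cong length (filter-reject <? n≮x)) (cong length (filter-accept ≡? x≡n))))))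
    split (yes n≤x) (no n≮x)  (no x≢n)  = ⊥-elim (x≢n (sym (ℕP.≤∧≮⇒≡ n≤x n≮x)))
    split (no n≰x)  (yes n<x) _         = ⊥-elim (n≰x (ℕP.<⇒≤ n<x))
    split (no n≰x)  _         (yes x≡n) = ⊥-elim (n≰x (ℕP.≤-reflexive (sym x≡n)))
    split (no n≰x)  (no n≮x)  (no x≢n)  = trans (cong length (filter-reject ≤? n≰x)) (trans IH
      (sym (cong₂ ℕ._+_ (cong length (filter-reject <? n≮x)) (cong length (filter-reject ≡? x≢n)))))

  downward-induction : (Q : ℕ → Set) {k : ℕ} → Q k → (∀ n → n ℕ.< k → Q (suc n) → Q n) → Q 0
  downward-induction Q {k} top step = from 0 k refl
    where
    from : ∀ n e → n ℕ.+ e ≡ k → Q n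
    from n zero    n+0≡k = subst Q (trans (sym n+0≡k) (ℕP.+-identityʳ n)) top
    from n (suc e) n+1+e≡k = step n (subst (n ℕ.<_) n+1+e≡k (ℕP.m<m+n n (s≤s z≤n)))
      (from (suc n) e (trans (sym (ℕP.+-suc n e)) n+1+e≡k))

  95≤32*n⇒3≤n : ∀ {n} → 95 ℕ.≤ 32 ℕ.* n → 3 ℕ.≤ n
  95≤32*n⇒3≤n {n} 95≤32n with 3 ℕ.≤? n
  ... | yes 3≤n = 3≤n
  ... | no  3≰n = ⊥-elim (from-no (95 ℕ.≤? 64) (ℕP.≤-trans 95≤32n (ℕP.*-monoʳ-≤ 32 (ℕP.≤-pred (ℕP.≰⇒> 3≰n)))))

  63t+32≤32v⇒3t+5<2v : ∀ {t v} → 4 ℕ.≤ t → 63 ℕ.* t ℕ.+ 32 ℕ.≤ 32 ℕ.* v → 3 ℕ.* t ℕ.+ 5 ℕ.< 2 ℕ.* v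
  63t+32≤32v⇒3t+5<2v {t} {v} 4≤t bound with 3 ℕ.* t ℕ.+ 5 ℕ.<? 2 ℕ.* v
  ... | yes lt = lt
  ... | no  ≮  = ⊥-elim (from-no (60 ℕ.≤? 48) (ℕP.≤-trans (ℕP.*-monoʳ-≤ 15 4≤t) 15t≤48))
    where
    open ℕ-Solver
    15t≤48 : 15 ℕ.* t ℕ.≤ 48
    15t≤48 = ℕP.+-cancelʳ-≤ (48 ℕ.* t ℕ.+ 32) (15 ℕ.* t) 48 (begin
      15 ℕ.* t ℕ.+ (48 ℕ.* t ℕ.+ 32)  ≡⟨ solve 1 (λ t → con 15 :* t :+ (con 48 :* t :+ con 32) := con 63 :* t :+ con 32) refl t ⟩
      63 ℕ.* t ℕ.+ 32                  ≤⟨ bound ⟩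
      32 ℕ.* v                         ≡⟨ ℕP.*-assoc 16 2 v ⟩
      16 ℕ.* (2 ℕ.* v)                 ≤⟨ ℕP.*-monoʳ-≤ 16 (ℕP.≮⇒≥ ≮) ⟩
      16 ℕ.* (3 ℕ.* t ℕ.+ 5)           ≡⟨ solve 1 (λ t → con 16 :* (con 3 :* t :+ con 5) := con 48 :+ (con 48 :* t :+ con 32)) refl t ⟩
      48 ℕ.+ (48 ℕ.* t ℕ.+ 32)         ∎)
      where open ℕP.≤-Reasoning

  layer-count : ∀ {A G s r N} → A ℕ.+ s ℕ.* s ℕ.≤ 2 ℕ.* s ℕ.* r ℕ.+ s → G ℕ.≤ 2 ℕ.* N → N ℕ.+ s ℕ.≤ r →
    (A ℕ.+ G) ℕ.+ suc s ℕ.* suc s ℕ.≤ 2 ℕ.* suc s ℕ.* r ℕ.+ suc s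
  layer-count {A} {G} {s} {r} {N} count G≤2N N+s≤r = begin
    (A ℕ.+ G) ℕ.+ suc s ℕ.* suc s
      ≡⟨ solve 3 (λ A G s → (A :+ G) :+ (con 1 :+ s) :* (con 1 :+ s)
                         := (A :+ s :* s) :+ (G :+ (con 2 :* s :+ con 1))) refl A G s ⟩
    (A ℕ.+ s ℕ.* s) ℕ.+ (G ℕ.+ (2 ℕ.* s ℕ.+ 1))
      ≤⟨ ℕP.+-mono-≤ count (ℕP.+-monoˡ-≤ (2 ℕ.* s ℕ.+ 1) G≤2N) ⟩
    (2 ℕ.* s ℕ.* r ℕ.+ s) ℕ.+ (2 ℕ.* N ℕ.+ (2 ℕ.* s ℕ.+ 1))
      ≡⟨ solve 3 (λ s r N → (con 2 :* s :* r :+ s) :+ (con 2 :* N :+ (con 2 :* s :+ con 1))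
                         := (con 2 :* s :* r :+ s :+ con 1) :+ con 2 :* (N :+ s)) refl s r N ⟩
    (2 ℕ.* s ℕ.* r ℕ.+ s ℕ.+ 1) ℕ.+ 2 ℕ.* (N ℕ.+ s)
      ≤⟨ ℕP.+-monoʳ-≤ (2 ℕ.* s ℕ.* r ℕ.+ s ℕ.+ 1) (ℕP.*-monoʳ-≤ 2 N+s≤r) ⟩
    (2 ℕ.* s ℕ.* r ℕ.+ s ℕ.+ 1) ℕ.+ 2 ℕ.* r
      ≡⟨ solve 2 (λ s r → (con 2 :* s :* r :+ s :+ con 1) :+ con 2 :* r
                       := con 2 :* (con 1 :+ s) :* r :+ (con 1 :+ s)) refl s r ⟩
    2 ℕ.* suc s ℕ.* r ℕ.+ suc s
      ∎
    where
    open ℕP.≤-Reasoning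
    open ℕ-Solver

  layers-total : ∀ {s r} → s ℕ.≤ r → 2 ℕ.* s ℕ.* r ℕ.+ s ℕ.≤ r ℕ.* (r ℕ.+ 1) ℕ.+ s ℕ.* s
  layers-total {s} {r} s≤r =
    subst (λ r → 2 ℕ.* s ℕ.* r ℕ.+ s ℕ.≤ r ℕ.* (r ℕ.+ 1) ℕ.+ s ℕ.* s) (ℕP.m+[n∸m]≡n s≤r)
      (ℕP.≤-trans (ℕP.m≤m+n _ (e ℕ.* e ℕ.+ e)) (ℕP.≤-reflexive
        (solve 2 (λ s e → (con 2 :* s :* (s :+ e) :+ s) :+ (e :* e :+ e)
                       := (s :+ e) :* ((s :+ e) :+ con 1) :+ s :* s) refl s e)))
    where
    open ℕ-Solver
    e = r ℕ.∸ s

  module Pruning {A B : Set} (_≟ᴮ_ : DecidableEquality B) (slots : A → List B) where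

    Covered : (Fin n → A) → B → Set
    Covered f v = ∃ λ i → v ∈ slots (f i)

    Redundant : (Fin n → A) → Fin n → Set
    Redundant f i = All (λ v → ∃ λ j → j ≢ i × v ∈ slots (f j)) (slots (f i))

    PrivateSlot : (Fin n → A) → Fin n → B → Set
    PrivateSlot f i v = v ∈ slots (f i) × ∀ j → j ≢ i → v ∉ slots (f j)

    Irredundant : (Fin n → A) → Set
    Irredundant f = ∀ i → ∃ (PrivateSlot f i)

    shared? : (f : Fin n → A) (i : Fin n) (v : B) → Dec (∃ λ j → j ≢ i × v ∈ slots (f j))
    shared? f i v = any? (λ j → ¬? (j ≟ i) ×-dec _∈?_ _≟ᴮ_ v (slots (f j)))

    redundant? : (f : Fin n → A) (i : Fin n) → Dec (Redundant f i)
    redundant? f i = All.all? (shared? f i) (slots (f i))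

    ¬Redundant⇒Irredundant : (f : Fin n → A) → (∀ i → ¬ Redundant f i) → Irredundant f
    ¬Redundant⇒Irredundant f nonredundant i with find (¬All⇒Any¬ (shared? f i) _ (nonredundant i))
    ... | v , v∈ , unshared = v , v∈ , λ j j≢i v∈j → unshared (j , j≢i , v∈j)

    record Pruned (f : Fin n → A) : Set where
      field
        size        : ℕ
        members     : Fin size → A
        drawn       : ∀ j → ∃ λ i → members j ≡ f i
        covering    : ∀ {v} → Covered f v → Covered members v
        irredundant : Irredundant members

    prune : (f : Fin n → A) → Pruned f
    prune {zero}  f = record { size = zero ; members = f ; drawn = λ j → j , refl ; covering = id ; irredundant = λ () }
    prune {suc n} f with any? (redundant? f)
    ... | no  none = record
      { size = suc n ; members = f ; drawn = λ j → j , refl ; covering = id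
      ; irredundant = ¬Redundant⇒Irredundant f (λ i red → none (i , red)) }
    ... | yes (i , red) = record
      { size = size ; members = members ; drawn = λ j → punchIn i (proj₁ (drawn j)) , proj₂ (drawn j)
      ; covering = covering ∘′ shrink ; irredundant = irredundant′ }
      where
      open Pruned (prune (removeAt f i)) renaming (irredundant to irredundant′)
      shrink : ∀ {v} → Covered f v → Covered (removeAt f i) v
      shrink {v} (j , v∈j) with i ≟ j
      ... | no  i≢j  = punchOut i≢j , subst (λ l → v ∈ slots (f l)) (sym (punchIn-punchOut i≢j)) v∈j
      ... | yes refl with All.lookup red v∈j
      ...   | j′ , j′≢i , v∈j′ =
        punchOut (j′≢i ∘′ sym) , subst (λ l → v ∈ slots (f l)) (sym (punchIn-punchOut (j′≢i ∘′ sym))) v∈j′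

  -- Parallelograms

  record Parallelogram (k : ℕ) : Set where
    constructor ⟨_,_,_⟩
    field
      opposite side₁ side₂ : Fin k

  open Parallelogram

  private
    variable
      a : Fin k
      P : Parallelogram k

  sides : Parallelogram k → List (Fin k)
  sides P = side₁ P ∷ side₂ P ∷ []

  corners : Fin k → Parallelogram k → List (Fin k)
  corners a P = a ∷ opposite P ∷ sides P

  Proper : Fin k → Parallelogram k → Set
  Proper a P = Unique (corners a P)

  -- x_a − x_{side₁} = x_{side₂} − x_{opposite}: the parallelogram a, side₁, opposite, side₂.
  contentAt : Fin k → Parallelogram k → Vecℚ k
  contentAt a P = content (a , side₁ P , side₂ P , opposite P)

  swap : Parallelogram k → Parallelogram k
  swap ⟨ z , x , y ⟩ = ⟨ z , y , x ⟩

  contentAt-swap : (a : Fin k) (P : Parallelogram k) → contentAt a (swap P) ≗ contentAt a P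
  contentAt-swap a ⟨ z , x , y ⟩ u = solve 4 (λ A X Y Z → ((A :- Y) :- X) :+ Z := ((A :- X) :- Y) :+ Z) refl
    (unit a u) (unit x u) (unit y u) (unit z u)
    where open ℚ-Solver

  contentAt-support : (a : Fin k) (P : Parallelogram k) → ∀ {u} → contentAt a P u ≢ 0ℚ → u ∈ corners a P
  contentAt-support a P =
    content-support (here refl) (there (there (here refl))) (there (there (there (here refl)))) (there (here refl))

  apex≢side₁ : Proper a P → a ≢ side₁ P
  apex≢side₁ ((_ ∷ a≢x ∷ _) ∷ _) = a≢x

  apex≢side₂ : Proper a P → a ≢ side₂ P
  apex≢side₂ ((_ ∷ _ ∷ a≢y ∷ _) ∷ _) = a≢y

  side₁≢side₂ : Proper a P → side₁ P ≢ side₂ P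
  side₁≢side₂ (_ ∷ _ ∷ (x≢y ∷ _) ∷ _) = x≢y

  contentAt-apex : Proper a P → contentAt a P a ≡ 1ℚ
  contentAt-apex {a = a} {P = P} ((a≢z ∷ a≢x ∷ a≢y ∷ []) ∷ _) =
    content-value a (side₁ P) (side₂ P) (opposite P)
      (unit-diag a) (unit-off (a≢x ∘ sym)) (unit-off (a≢y ∘ sym)) (unit-off (a≢z ∘ sym))

  contentAt-side₁ : Proper a P → contentAt a P (side₁ P) ≡ - 1ℚ
  contentAt-side₁ {a = a} {P = P} ((_ ∷ a≢x ∷ _) ∷ (z≢x ∷ _) ∷ (x≢y ∷ []) ∷ [] ∷ []) =
    content-value a (side₁ P) (side₂ P) (opposite P)
      (unit-off a≢x) (unit-diag (side₁ P)) (unit-off (x≢y ∘ sym)) (unit-off z≢x)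

  contentAt-side₂ : Proper a P → contentAt a P (side₂ P) ≡ - 1ℚ
  contentAt-side₂ {a = a} {P = P} ((_ ∷ _ ∷ a≢y ∷ []) ∷ (_ ∷ z≢y ∷ []) ∷ (x≢y ∷ []) ∷ [] ∷ []) =
    content-value a (side₁ P) (side₂ P) (opposite P)
      (unit-off a≢y) (unit-off x≢y) (unit-diag (side₂ P)) (unit-off z≢y)

  -1≢0 : - 1ℚ ≢ 0ℚ
  -1≢0 ()

  Below : Fin k → Parallelogram k → Set
  Below a P = All (Fin._< a) (opposite P ∷ sides P)

  Proper-swap : Proper a P → Proper a (swap P)
  Proper-swap ((a≢z ∷ a≢x ∷ a≢y ∷ []) ∷ (z≢x ∷ z≢y ∷ []) ∷ (x≢y ∷ []) ∷ [] ∷ []) =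
    (a≢z ∷ a≢y ∷ a≢x ∷ []) ∷ (z≢y ∷ z≢x ∷ []) ∷ ((x≢y ∘ sym) ∷ []) ∷ [] ∷ []

  Below-swap : Below a P → Below a (swap P)
  Below-swap (z<a ∷ x<a ∷ y<a ∷ []) = z<a ∷ y<a ∷ x<a ∷ []

  contentAt-vanishes : Below a P → ∀ {l} → a Fin.< l → contentAt a P l ≡ 0ℚ
  contentAt-vanishes {a = a} {P = P} below {l} a<l =
    decidable-stable (contentAt a P l ℚP.≟ 0ℚ) (λ ≢0 → outside (contentAt-support a P ≢0))
    where
    outside : l ∉ corners a P
    outside (here l≡a)  = <⇒≢ a<l (sym l≡a)
    outside (there l∈)  = ℕP.<-asym (All.lookup below l∈) a<l

  orient : (P : Parallelogram k) {v : Fin k} → v ∈ sides P → Parallelogram k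
  orient P (here _)  = P
  orient P (there _) = swap P

  orient-side₁ : (P : Parallelogram k) {v : Fin k} (v∈ : v ∈ sides P) → side₁ (orient P v∈) ≡ v
  orient-side₁ P (here v≡x)         = sym v≡x
  orient-side₁ P (there (here v≡y)) = sym v≡y

  orient-sides : (P : Parallelogram k) {v u : Fin k} (v∈ : v ∈ sides P) → u ∈ sides (orient P v∈) → u ∈ sides P
  orient-sides P (here _)  u∈                = u∈
  orient-sides P (there _) (here u≡y)        = there (here u≡y)
  orient-sides P (there _) (there (here u≡x)) = here u≡x

  -- Good configurations

  module GoodConfiguration {k m} {c : ℚ} {C : Config k m}
    (63≤32c : ℕ→ℚ 63 ≤ ℕ→ℚ 32 * c) (good : Good c C) where

    open Pruning (_≟_ {k}) (sides {k})

    light-bound : 1 ℕ.≤ t → (w : Fin t → Vecℚ k) → (∀ j → Implies C (w j)) → Independent w →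
      63 ℕ.* t ℕ.+ 32 ℕ.≤ 32 ℕ.* varCount w
    light-bound {t} 1≤t w w-imp w-ind = ℕ→ℚ-cancel-≤ (begin
      ℕ→ℚ (63 ℕ.* t ℕ.+ 32)          ≡⟨ trans (ℕ→ℚ-+ (63 ℕ.* t) 32) (cong (_+ ℕ→ℚ 32) (ℕ→ℚ-* 63 t)) ⟩
      ℕ→ℚ 63 * T + ℕ→ℚ 32            ≤⟨ ℚP.+-monoˡ-≤ (ℕ→ℚ 32) (ℚP.*-monoʳ-≤-nonNeg T {{ℕ→ℚ-nonNeg t}} 63≤32c) ⟩
      ℕ→ℚ 32 * c * T + ℕ→ℚ 32        ≡⟨ solve 3 (λ a c t → a :* c :* t :+ a := a :* (c :* t :+ con 1ℚ)) refl (ℕ→ℚ 32) c T ⟩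
      ℕ→ℚ 32 * (c * T + 1ℚ)          ≤⟨ ℚP.*-monoˡ-≤-nonNeg (ℕ→ℚ 32) {{ℕ→ℚ-nonNeg 32}} light ⟩
      ℕ→ℚ 32 * ℕ→ℚ (varCount w)      ≡⟨ ℕ→ℚ-* 32 (varCount w) ⟨
      ℕ→ℚ (32 ℕ.* varCount w)        ∎)
      where
      open ℚP.≤-Reasoning
      open ℚ-Solver
      T = ℕ→ℚ t
      light : c * T + 1ℚ ≤ ℕ→ℚ (varCount w)
      light = proj₂ (proj₂ good) t 1≤t w w-imp w-ind

    support≥4 : {v : Vecℚ k} → Implies C v → ∀ {u} → v u ≢ 0ℚ →
      (L : List (Fin k)) → (∀ u → v u ≢ 0ℚ → u ∈ L) → 4 ℕ.≤ length L
    support≥4 {v} v-imp {u} vu≢0 L support⊆L =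
      ℕP.≤-trans 4≤V (varCount≤length (λ _ → v) L (λ u (_ , ≢0) → support⊆L u ≢0))
      where
      V = varCount (λ (_ : Fin 1) → v)
      v-ind : Independent (λ (_ : Fin 1) → v)
      v-ind μ dep zero = *-≡0⇒≡0 vu≢0 (trans (sym (ℚP.+-identityʳ _)) (dep u))
      4≤V : 4 ℕ.≤ V
      4≤V = ℕP.≤∧≢⇒< (95≤32*n⇒3≤n (light-bound (s≤s z≤n) (λ _ → v) (λ _ → v-imp) v-ind))
                      (λ 3≡V → proj₁ (proj₂ good) v v-imp (sym 3≡V))

    support-spread : 4 ℕ.≤ t → (w : Fin t → Vecℚ k) → (∀ j → Implies C (w j)) → Independent w →
      (L : List (Fin k)) → (∀ u → (∃ λ j → w j u ≢ 0ℚ) → u ∈ L) → 3 ℕ.* t ℕ.+ 5 ℕ.< 2 ℕ.* length L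
    support-spread 4≤t w w-imp w-ind L support⊆L = ℕP.<-≤-trans
      (63t+32≤32v⇒3t+5<2v {v = varCount w} 4≤t (light-bound (ℕP.≤-trans (s≤s z≤n) 4≤t) w w-imp w-ind))
      (ℕP.*-monoʳ-≤ 2 (varCount≤length w L support⊆L))

    SidesPrivate : (Fin n → Parallelogram k) → Set
    SidesPrivate P = ∀ i j → i ≢ j → side₁ (P i) ∉ sides (P j)

    module FullDependency (a : Fin k) {N : ℕ} (P : Fin (suc N) → Parallelogram k) (proper : ∀ i → Proper a (P i))
      (implied : ∀ i → Implies C (contentAt a (P i))) (private₁ : SidesPrivate P)
      (μ : Fin (suc N) → ℚ) (dep : ∀ u → lincomb (contentAt a ∘ P) μ u ≡ 0ℚ) (μ≢0 : ∀ i → μ i ≢ 0ℚ)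
      (tail-ind : Independent (contentAt a ∘ P ∘ suc)) where

      w : Fin (suc N) → Vecℚ k
      w = contentAt a ∘ P

      x y z : Fin (suc N) → Fin k
      x = side₁ ∘ P
      y = side₂ ∘ P
      z = opposite ∘ P

      x-injective : ∀ {i j} → x i ≡ x j → i ≡ j
      x-injective {i} {j} xi≡xj with i ≟ j
      ... | yes i≡j = i≡j
      ... | no  i≢j = ⊥-elim (private₁ i j i≢j (here xi≡xj))

      x≢y : ∀ i j → x i ≢ y j
      x≢y i j with i ≟ j
      ... | yes refl = side₁≢side₂ (proper i)
      ... | no  i≢j  = λ xi≡yj → private₁ i j i≢j (there (here xi≡yj))

      shared : ∀ i v → w i v ≢ 0ℚ → ∃ λ j → j ≢ i × w j v ≢ 0ℚ
      shared = lincomb≡0-shared w μ dep μ≢0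

      -- x i must occur in another member; privacy leaves only its opposite corner.
      partner : ∀ i → ∃ λ j → z j ≡ x i
      partner i = locate (shared i (x i) (λ eq → -1≢0 (trans (sym (contentAt-side₁ (proper i))) eq)))
        where
        corner : ∀ j → j ≢ i → x i ∈ corners a (P j) → ∃ λ j → z j ≡ x i
        corner j _   (here xi≡a)             = ⊥-elim (apex≢side₁ (proper i) (sym xi≡a))
        corner j _   (there (here xi≡zj))    = j , sym xi≡zj
        corner j j≢i (there (there xi∈sides)) = ⊥-elim (private₁ i j (j≢i ∘ sym) xi∈sides)
        locate : (∃ λ j → j ≢ i × w j (x i) ≢ 0ℚ) → ∃ λ j → z j ≡ x i
        locate (j , j≢i , wj≢0) = corner j j≢i (contentAt-support a (P j) wj≢0)

      mate : Fin (suc N) → Fin (suc N)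
      mate i = proj₁ (partner i)

      z-mate : ∀ i → z (mate i) ≡ x i
      z-mate i = proj₂ (partner i)

      mate-injective : ∀ {i i′} → mate i ≡ mate i′ → i ≡ i′
      mate-injective {i} {i′} eq = x-injective (trans (sym (z-mate i)) (trans (cong z eq) (z-mate i′)))

      mate-surjective : ∀ j → ∃ λ i → mate i ≡ j
      mate-surjective = Fin-injective⇒surjective mate mate-injective

      z-is-x : ∀ j → ∃ λ i → z j ≡ x i
      z-is-x j = let i , mate-i≡j = mate-surjective j in i , trans (cong z (sym mate-i≡j)) (z-mate i)

      z≡x⇒≡mate : ∀ {i j} → z j ≡ x i → j ≡ mate i
      z≡x⇒≡mate {i} {j} zj≡xi = let i′ , mate-i′≡j = mate-surjective j in
        trans (sym mate-i′≡j) (cong mate (x-injective (trans (sym (z-mate i′)) (trans (cong z mate-i′≡j) zj≡xi))))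

      z≢y : ∀ i j → z j ≢ y i
      z≢y i j zj≡yi = let i′ , zj≡xi′ = z-is-x j in x≢y i′ i (trans (sym zj≡xi′) zj≡yi)

      y-repeated : ∀ i → ∃ λ i′ → i′ ≢ i × y i′ ≡ y i
      y-repeated i = locate (shared i (y i) (λ eq → -1≢0 (trans (sym (contentAt-side₂ (proper i))) eq)))
        where
        corner : ∀ j → j ≢ i → y i ∈ corners a (P j) → ∃ λ i′ → i′ ≢ i × y i′ ≡ y i
        corner j _   (here yi≡a)                    = ⊥-elim (apex≢side₂ (proper i) (sym yi≡a))
        corner j _   (there (here yi≡zj))           = ⊥-elim (z≢y i j (sym yi≡zj))
        corner j _   (there (there (here yi≡xj)))   = ⊥-elim (x≢y j i (sym yi≡xj))
        corner j j≢i (there (there (there (here yi≡yj)))) = j , j≢i , sym yi≡yj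
        locate : (∃ λ j → j ≢ i × w j (y i) ≢ 0ℚ) → ∃ λ i′ → i′ ≢ i × y i′ ≡ y i
        locate (j , j≢i , wj≢0) = corner j j≢i (contentAt-support a (P j) wj≢0)

      R : List (Fin k)
      R = image y

      2|R|≤1+N : 2 ℕ.* length R ℕ.≤ suc N
      2|R|≤1+N = repeated⇒2|image|≤n y y-repeated

      ∈xs : ∀ {u} i → u ≡ x i → u ∈ a ∷ (tabulate x ++ R)
      ∈xs i u≡xi = there (∈-++⁺ˡ (subst (_∈ tabulate x) (sym u≡xi) (∈-tabulate⁺ {f = x} i)))

      support⊆ : ∀ u → (∃ λ j → w j u ≢ 0ℚ) → u ∈ a ∷ (tabulate x ++ R)
      support⊆ u (j , wju≢0) = corner (contentAt-support a (P j) wju≢0)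
        where
        corner : u ∈ corners a (P j) → u ∈ a ∷ (tabulate x ++ R)
        corner (here u≡a)                          = here u≡a
        corner (there (here u≡zj))                 = ∈xs _ (trans u≡zj (proj₂ (z-is-x j)))
        corner (there (there (here u≡xj)))         = ∈xs j u≡xj
        corner (there (there (there (here u≡yj)))) = there (∈-++⁺ʳ (tabulate x) (subst (_∈ R) (sym u≡yj) (∈-image⁺ y j)))

      large : 4 ℕ.≤ N → ⊥
      large 4≤N = ℕP.<⇒≱ (support-spread 4≤N (w ∘ suc) (implied ∘ suc) tail-ind L support⊆L) 2|L|≤3N+5
        where
        open ℕ-Solver
        L = a ∷ (tabulate x ++ R)
        support⊆L : ∀ u → (∃ λ j → w (suc j) u ≢ 0ℚ) → u ∈ L
        support⊆L u (j , ≢0) = support⊆ u (suc j , ≢0)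
        2|L|≤3N+5 : 2 ℕ.* length L ℕ.≤ 3 ℕ.* N ℕ.+ 5
        2|L|≤3N+5 = begin
          2 ℕ.* length L
            ≡⟨ cong (λ l → 2 ℕ.* suc l) (trans (length-++ (tabulate x)) (cong (ℕ._+ length R) (length-tabulate x))) ⟩
          2 ℕ.* suc (suc N ℕ.+ length R)
            ≡⟨ solve 2 (λ N r → con 2 :* (con 1 :+ (con 1 :+ N :+ r)) := (con 4 :+ con 2 :* N) :+ con 2 :* r) refl N (length R) ⟩
          (4 ℕ.+ 2 ℕ.* N) ℕ.+ 2 ℕ.* length R
            ≤⟨ ℕP.+-monoʳ-≤ (4 ℕ.+ 2 ℕ.* N) 2|R|≤1+N ⟩
          (4 ℕ.+ 2 ℕ.* N) ℕ.+ suc N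
            ≡⟨ solve 1 (λ N → (con 4 :+ con 2 :* N) :+ (con 1 :+ N) := con 3 :* N :+ con 5) refl N ⟩
          3 ℕ.* N ℕ.+ 5
            ∎
          where open ℕP.≤-Reasoning

      -- For at most four members, summing them cancels every x i against its mate,
      -- leaving an implied equation supported on a and at most two values of y.
      small : N ℕ.≤ 3 → ⊥
      small N≤3 = from-no (4 ℕ.≤? 3) (ℕP.≤-trans (support≥4 s-implied s-apex≢0 (a ∷ R) s-support) (s≤s |R|≤2))
        where
        open ℚ-Solver
        s : Vecℚ k
        s = lincomb w (const 1ℚ)

        s-implied : Implies C s
        s-implied = Implies-lincomb C w (const 1ℚ) implied

        s-apex≢0 : s a ≢ 0ℚ
        s-apex≢0 sa≡0 = ℚP.1≢0 (nonneg-+-≡0ˡ 0≤1 (sumFin-nonneg {N} (λ _ → 0≤1)) ones≡0)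
          where
          0≤1 : 0ℚ ≤ 1ℚ
          0≤1 = from-yes (0ℚ ℚP.≤? 1ℚ)
          ones≡0 : sumFin {suc N} (const 1ℚ) ≡ 0ℚ
          ones≡0 = trans (sumFin-cong (λ j → sym (trans (ℚP.*-identityˡ _) (contentAt-apex (proper j))))) sa≡0

        s-x≡0 : ∀ i → s (x i) ≡ 0ℚ
        s-x≡0 i = begin
          sumFin (λ j → 1ℚ * w j (x i))                                        ≡⟨ sumFin-cong (λ j → trans (ℚP.*-identityˡ _) (w-at-x j)) ⟩
          sumFin (λ j → unit (z j) (x i) - unit (x j) (x i))                   ≡⟨ sumFin-- (λ j → unit (z j) (x i)) (λ j → unit (x j) (x i)) ⟩
          sumFin (λ j → unit (z j) (x i)) - sumFin (λ j → unit (x j) (x i))    ≡⟨ cong₂ _-_ zs xs ⟩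
          1ℚ - 1ℚ                                                              ≡⟨ ℚP.+-inverseʳ 1ℚ ⟩
          0ℚ                                                                   ∎
          where
          open ≡-Reasoning
          w-at-x : ∀ j → w j (x i) ≡ unit (z j) (x i) - unit (x j) (x i)
          w-at-x j = trans
            (content-value a (x j) (y j) (z j) (unit-off (apex≢side₁ (proper i))) refl (unit-off (x≢y i j ∘ sym)) refl)
            (solve 2 (λ p q → ((con 0ℚ :- p) :- con 0ℚ) :+ q := q :- p) refl (unit (x j) (x i)) (unit (z j) (x i)))
          zs : sumFin (λ j → unit (z j) (x i)) ≡ 1ℚ
          zs = trans (sumFin-single (mate i) (λ j j≢mate → unit-off (j≢mate ∘ z≡x⇒≡mate)))
                     (trans (cong (λ v → unit v (x i)) (z-mate i)) (unit-diag (x i)))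
          xs : sumFin (λ j → unit (x j) (x i)) ≡ 1ℚ
          xs = trans (sumFin-single i (λ j j≢i → unit-off (j≢i ∘ x-injective))) (unit-diag (x i))

        s-support : ∀ u → s u ≢ 0ℚ → u ∈ a ∷ R
        s-support u su≢0 = locate (sumFin≢0⇒∃≢0 (λ j → 1ℚ * w j u) su≢0)
          where
          s-side₁ : ∀ {i} → u ≡ x i → s u ≡ 0ℚ
          s-side₁ {i} u≡xi = subst (λ v → s v ≡ 0ℚ) (sym u≡xi) (s-x≡0 i)
          corner : ∀ j → u ∈ corners a (P j) → u ∈ a ∷ R
          corner j (here u≡a)                          = here u≡a
          corner j (there (here u≡zj))                 = ⊥-elim (su≢0 (s-side₁ (trans u≡zj (proj₂ (z-is-x j)))))
          corner j (there (there (here u≡xj)))         = ⊥-elim (su≢0 (s-side₁ u≡xj))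
          corner j (there (there (there (here u≡yj)))) = there (subst (_∈ R) (sym u≡yj) (∈-image⁺ y j))
          locate : (∃ λ j → 1ℚ * w j u ≢ 0ℚ) → u ∈ a ∷ R
          locate (j , term≢0) = corner j (contentAt-support a (P j) (λ wju≡0 → term≢0 (trans (ℚP.*-identityˡ _) wju≡0)))

        |R|≤2 : length R ℕ.≤ 2
        |R|≤2 = ℕP.*-cancelˡ-≤ 2 (ℕP.≤-trans 2|R|≤1+N (s≤s N≤3))

      impossible : ⊥
      impossible with 4 ℕ.≤? N
      ... | yes 4≤N = large 4≤N
      ... | no  4≰N = small (ℕP.≤-pred (ℕP.≰⇒> 4≰N))

    private-independent : (a : Fin k) (P : Fin n → Parallelogram k) → (∀ i → Proper a (P i)) →
      (∀ i → Implies C (contentAt a (P i))) → SidesPrivate P → Independent (contentAt a ∘ P)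
    private-independent {zero}  a P _ _ _ μ _ ()
    private-independent {suc N} a P proper implied private₁ μ dep = decide (any? (λ i → μ i ℚP.≟ 0ℚ))
      where
      private-removeAt : ∀ i → SidesPrivate (removeAt P i)
      private-removeAt i j j′ j≢j′ = private₁ (punchIn i j) (punchIn i j′) (j≢j′ ∘ punchIn-injective i j j′)
      private-tail : SidesPrivate (P ∘ suc)
      private-tail i j i≢j = private₁ (suc i) (suc j) (i≢j ∘ suc-injective)
      decide : Dec (∃ λ i → μ i ≡ 0ℚ) → ∀ j → μ j ≡ 0ℚ
      decide (yes (i , μi≡0)) = Independent-removeAt (contentAt a ∘ P) i
        (private-independent a (removeAt P i) (proper ∘ punchIn i) (implied ∘ punchIn i) (private-removeAt i))
        μ dep μi≡0
      decide (no none) = ⊥-elim (FullDependency.impossible a P proper implied private₁ μ dep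
        (λ i μi≡0 → none (i , μi≡0))
        (private-independent a (P ∘ suc) (proper ∘ suc) (implied ∘ suc) private-tail))

    record Admissible (a : Fin k) (P : Parallelogram k) : Set where
      field
        proper  : Proper a P
        implied : Implies C (contentAt a P)
        below   : Below a P

    open Admissible

    Admissible-orient : {a : Fin k} {P : Parallelogram k} {v : Fin k} →
      Admissible a P → (v∈ : v ∈ sides P) → Admissible a (orient P v∈)
    Admissible-orient adm (here _)  = adm
    Admissible-orient {a = a} {P} adm (there _) = record
      { proper  = Proper-swap (proper adm)
      ; implied = Implies-cong C (contentAt-swap a P) (implied adm)
      ; below   = Below-swap (below adm)
      }

    certified⇒admissible : ∀ {a b} → Certifies C (a , b) → ∃ λ P → side₁ P ≡ b × Admissible a P
    certified⇒admissible {a} {b} (b<a , a′ , b′ , inj₂ (refl , a′<b) , imp) = ⊥-elim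
      (from-no (4 ℕ.≤? 3) (support≥4 imp va≢0 (a ∷ b ∷ a′ ∷ [])
        (λ u → content-support (here refl) (there (here refl)) (there (there (here refl))) (here refl))))
      where
      va≡2 : content (a , b , a′ , a) a ≡ ℕ→ℚ 2
      va≡2 = content-value a b a′ a (unit-diag a) (unit-off (<⇒≢ b<a)) (unit-off (<⇒≢ (ℕP.<-trans a′<b b<a))) (unit-diag a)
      va≢0 : content (a , b , a′ , a) a ≢ 0ℚ
      va≢0 va≡0 with trans (sym va≡2) va≡0
      ... | ()
    certified⇒admissible {a} {b} (b<a , a′ , b′ , inj₁ (a′<a , b′<a) , imp) =
      ⟨ b′ , b , a′ ⟩ , refl , record
        { proper  = (≢a b′<a ∷ ≢a b<a ∷ ≢a a′<a ∷ []) ∷ (b′≢b ∷ b′≢a′ ∷ []) ∷ (b≢a′ ∷ []) ∷ [] ∷ []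
        ; implied = imp
        ; below   = b′<a ∷ b<a ∷ a′<a ∷ []
        }
      where
      ≢a : ∀ {u} → u Fin.< a → a ≢ u
      ≢a u<a = <⇒≢ u<a ∘ sym
      va≡1 : content (a , b , a′ , b′) a ≡ 1ℚ
      va≡1 = content-value a b a′ b′ (unit-diag a) (unit-off (<⇒≢ b<a)) (unit-off (<⇒≢ a′<a)) (unit-off (<⇒≢ b′<a))
      va≢0 : content (a , b , a′ , b′) a ≢ 0ℚ
      va≢0 va≡0 = ℚP.1≢0 (trans (sym va≡1) va≡0)
      -- a repeated index would leave an implied equation with at most three variables
      narrow : ∀ {L} → length L ℕ.≤ 3 → a ∈ L → b ∈ L → a′ ∈ L → b′ ∈ L → ⊥
      narrow {L} |L|≤3 ∈a ∈b ∈a′ ∈b′ =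
        ℕP.<⇒≱ (s≤s |L|≤3) (support≥4 imp va≢0 L (λ u → content-support ∈a ∈b ∈a′ ∈b′))
      b′≢b : b′ ≢ b
      b′≢b b′≡b = narrow {a ∷ b ∷ a′ ∷ []} ℕP.≤-refl
        (here refl) (there (here refl)) (there (there (here refl))) (there (here b′≡b))
      b′≢a′ : b′ ≢ a′
      b′≢a′ b′≡a′ = narrow {a ∷ b ∷ a′ ∷ []} ℕP.≤-refl
        (here refl) (there (here refl)) (there (there (here refl))) (there (there (here b′≡a′)))
      b≢a′ : b ≢ a′
      b≢a′ b≡a′ = narrow {a ∷ b ∷ b′ ∷ []} ℕP.≤-refl
        (here refl) (there (here refl)) (there (here (sym b≡a′))) (there (there (here refl)))

    CertifiedAt : Fin k → Fin k × Fin k → Set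
    CertifiedAt α p = Certifies C p × proj₁ p ≡ α

    certifiedAt⇒admissible : ∀ {α p} → CertifiedAt α p → ∃ λ P → side₁ P ≡ proj₂ p × Admissible α P
    certifiedAt⇒admissible {p = _ , _} (cert , refl) = certified⇒admissible cert

    record Layer (α : Fin k) (G : List (Fin k × Fin k)) : Set where
      field
        size        : ℕ
        family      : Fin size → Vecℚ k
        implied     : ∀ i → Implies C (family i)
        independent : Independent family
        vanishes    : ∀ i {l} → α Fin.< l → family i l ≡ 0ℚ
        covers      : length G ℕ.≤ 2 ℕ.* size

    layer : (α : Fin k) (G : List (Fin k × Fin k)) → Unique G → All (CertifiedAt α) G → Layer α G
    layer α G G! G-cert = record
      { size        = size
      ; family      = contentAt α ∘ o
      ; implied     = implied ∘ o-admissible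
      ; independent = private-independent α o (proper ∘ o-admissible) (implied ∘ o-admissible) o-private
      ; vanishes    = λ j → contentAt-vanishes (below (o-admissible j))
      ; covers      = |G|≤2size
      }
      where
      witness : (i : Fin (length G)) → ∃ λ P → side₁ P ≡ proj₂ (lookup G i) × Admissible α P
      witness i = certifiedAt⇒admissible (All.lookup G-cert (∈-lookup i))

      f : Fin (length G) → Parallelogram k
      f i = proj₁ (witness i)

      open Pruned (prune f)

      g-admissible : ∀ j → Admissible α (members j)
      g-admissible j = let i , gj≡fi = drawn j in subst (Admissible α) (sym gj≡fi) (proj₂ (proj₂ (witness i)))

      o : Fin size → Parallelogram k
      o j = orient (members j) (proj₁ (proj₂ (irredundant j)))

      o-admissible : ∀ j → Admissible α (o j)
      o-admissible j = Admissible-orient (g-admissible j) _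

      o-private : SidesPrivate o
      o-private i j i≢j xi∈oj = proj₂ (proj₂ (irredundant i)) j (i≢j ∘ sym)
        (orient-sides (members j) (proj₁ (proj₂ (irredundant j)))
          (subst (_∈ sides (o j)) (orient-side₁ (members i) (proj₁ (proj₂ (irredundant i)))) xi∈oj))

      sideList : List (Fin k)
      sideList = tabulate (side₁ ∘ members) ++ tabulate (side₂ ∘ members)

      covered⇒∈ : ∀ {v} → Covered members v → v ∈ sideList
      covered⇒∈ (j , here v≡x)         = ∈-++⁺ˡ (subst (_∈ _) (sym v≡x) (∈-tabulate⁺ {f = side₁ ∘ members} j))
      covered⇒∈ (j , there (here v≡y)) = ∈-++⁺ʳ _ (subst (_∈ _) (sym v≡y) (∈-tabulate⁺ {f = side₂ ∘ members} j))

      G⊆ : ∀ {p} → p ∈ G → p ∈ map (α ,_) sideList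
      G⊆ {p} p∈G = subst (_∈ map (α ,_) sideList) (sym p≡) (∈-map⁺ (α ,_) (covered⇒∈ (covering (i , here refl))))
        where
        i = Any.index p∈G
        p≡ : p ≡ (α , side₁ (f i))
        p≡ = trans (lookup-index p∈G)
          (cong₂ _,_ (proj₂ (All.lookup G-cert (∈-lookup i))) (sym (proj₁ (proj₂ (witness i)))))

      |G|≤2size : length G ℕ.≤ 2 ℕ.* size
      |G|≤2size = begin
        length G                                ≤⟨ Unique-⊆⇒length≤ G! G⊆ ⟩
        length (map (α ,_) sideList)            ≡⟨ length-map (α ,_) sideList ⟩
        length sideList                         ≡⟨ length-++ (tabulate (side₁ ∘ members)) ⟩
        length (tabulate (side₁ ∘ members)) ℕ.+ length (tabulate (side₂ ∘ members))
                                                ≡⟨ cong₂ ℕ._+_ (length-tabulate (side₁ ∘ members)) (length-tabulate (side₂ ∘ members)) ⟩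
        size ℕ.+ size                           ≡⟨ cong (size ℕ.+_) (ℕP.+-identityʳ size) ⟨
        2 ℕ.* size                              ∎
        where open ℕP.≤-Reasoning

    module Counting {d} {B : Fin d → Vecℚ k} (B-sol : ∀ j → Solution C (B j)) (B-ind : Independent B)
      {pairs : List (Fin k × Fin k)} (pairs! : Unique pairs) (pairs-cert : All (Certifies C) pairs) where

      r : ℕ
      r = k ℕ.∸ d

      VanishesFrom : ℕ → Vecℚ k → Set
      VanishesFrom n v = ∀ {l} → n ℕ.≤ toℕ l → v l ≡ 0ℚ

      -- Room for the s equations with distinct leading indices ≥ n found so far, one per
      -- nonempty layer: they extend every independent implied family vanishing from n on.
      Room : ℕ → ℕ → Set
      Room s n = ∀ {t} (F : Fin t → Vecℚ k) → (∀ i → Implies C (F i)) → Independent F →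
        (∀ i → VanishesFrom n (F i)) → t ℕ.+ s ℕ.≤ r

      above : ℕ → List (Fin k × Fin k)
      above n = filter (λ p → n ℕ.≤? toℕ (proj₁ p)) pairs

      at : ℕ → List (Fin k × Fin k)
      at n = filter (λ p → toℕ (proj₁ p) ℕ.≟ n) pairs

      -- The j-th nonempty layer from the top has at most 2 (r − j) pairs.
      Invariant : ℕ → Set
      Invariant n = ∃ λ s → Room s n × length (above n) ℕ.+ s ℕ.* s ℕ.≤ 2 ℕ.* s ℕ.* r ℕ.+ s

      invariant-top : Invariant k
      invariant-top = 0 , room₀ , ℕP.≤-reflexive (trans (ℕP.+-identityʳ _) |above-k|≡0)
        where
        room₀ : Room 0 k
        room₀ {t} F F-imp F-ind _ = subst (ℕ._≤ r) (sym (ℕP.+-identityʳ t))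
          (ℕP.m+n≤o⇒m≤o∸n t (implied+solutions⇒≤ C F B F-imp F-ind B-sol B-ind))
        |above-k|≡0 : length (above k) ≡ 0
        |above-k|≡0 = cong length (filter-none (λ p → k ℕ.≤? toℕ (proj₁ p)) {xs = pairs}
          (All.tabulate (λ {p} _ → ℕP.<⇒≱ (toℕ<n (proj₁ p)))))

      invariant-step : ∀ n → n ℕ.< k → Invariant (suc n) → Invariant n
      invariant-step n n<k (s , room , count) =
        extend (at n) (filter⁺ _ pairs!) (All.tabulate at-n-certified) (length-filter-≤ (toℕ ∘ proj₁) n pairs)
        where
        α : Fin k
        α = fromℕ< n<k

        α≡n : toℕ α ≡ n
        α≡n = toℕ-fromℕ< n<k

        α< : ∀ {l} → suc n ℕ.≤ toℕ l → α Fin.< l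
        α< {l} = subst (λ a → suc a ℕ.≤ toℕ l) (sym α≡n)

        at-n-certified : ∀ {p} → p ∈ at n → CertifiedAt α p
        at-n-certified p∈ = let p∈pairs , p₁≡n = ∈-filter⁻ (λ p → toℕ (proj₁ p) ℕ.≟ n) {xs = pairs} p∈ in
          All.lookup pairs-cert p∈pairs , toℕ-injective (trans p₁≡n (sym α≡n))

        room-weaken : Room s n
        room-weaken F F-imp F-ind F-van = room F F-imp F-ind (λ i n<l → F-van i (ℕP.<⇒≤ n<l))

        extend : (G : List (Fin k × Fin k)) → Unique G → All (CertifiedAt α) G →
          length (above n) ≡ length (above (suc n)) ℕ.+ length G → Invariant n
        extend [] _ _ split = s , room-weaken ,
          subst (λ a → a ℕ.+ s ℕ.* s ℕ.≤ 2 ℕ.* s ℕ.* r ℕ.+ s) (sym (trans split (ℕP.+-identityʳ _))) count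
        extend G@(_ ∷ _) G! G-cert@(p-cert ∷ _) split = suc s , room-grow ,
          subst (λ a → a ℕ.+ suc s ℕ.* suc s ℕ.≤ 2 ℕ.* suc s ℕ.* r ℕ.+ suc s) (sym split)
            (layer-count count (Layer.covers L) size+s≤r)
          where
          L : Layer α G
          L = layer α G G! G-cert

          size+s≤r : Layer.size L ℕ.+ s ℕ.≤ r
          size+s≤r = room (Layer.family L) (Layer.implied L) (Layer.independent L) (λ i → Layer.vanishes L i ∘ α<)

          Q : Parallelogram k
          Q = proj₁ (certifiedAt⇒admissible p-cert)

          Q-admissible : Admissible α Q
          Q-admissible = proj₂ (proj₂ (certifiedAt⇒admissible p-cert))

          room-grow : Room (suc s) n
          room-grow {t} F F-imp F-ind F-van =
            subst (ℕ._≤ r) (sym (ℕP.+-suc t s)) (room (contentAt α Q Vector.∷ F) QF-imp QF-ind QF-van)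
            where
            QF-imp : ∀ i → Implies C ((contentAt α Q Vector.∷ F) i)
            QF-imp zero    = implied Q-admissible
            QF-imp (suc i) = F-imp i
            QF-ind : Independent (contentAt α Q Vector.∷ F)
            QF-ind = Independent-∷ (contentAt α Q) F α
              (λ eq → ℚP.1≢0 (trans (sym (contentAt-apex (proper Q-admissible))) eq))
              (λ i → F-van i (ℕP.≤-reflexive (sym α≡n))) F-ind
            QF-van : ∀ i → VanishesFrom (suc n) ((contentAt α Q Vector.∷ F) i)
            QF-van zero    = contentAt-vanishes (below Q-admissible) ∘ α<
            QF-van (suc i) = F-van i ∘ ℕP.<⇒≤

      certified≤ : length pairs ℕ.≤ r ℕ.* (r ℕ.+ 1)
      certified≤ with downward-induction Invariant invariant-top invariant-step
      ... | s , room , count = ℕP.+-cancelʳ-≤ (s ℕ.* s) (length pairs) (r ℕ.* (r ℕ.+ 1))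
        (ℕP.≤-trans (subst (λ a → a ℕ.+ s ℕ.* s ℕ.≤ 2 ℕ.* s ℕ.* r ℕ.+ s) |above-0|≡|pairs| count)
                    (layers-total (room {0} (λ ()) (λ ()) (λ _ _ ()) (λ ()))))
        where
        |above-0|≡|pairs| : length (above 0) ≡ length pairs
        |above-0|≡|pairs| =
          cong length (filter-all (λ p → 0 ℕ.≤? toℕ (proj₁ p)) {xs = pairs} (All.tabulate (λ _ → z≤n)))

open import Data.Nat using (ℕ; _≤_; _<_; _∸_; _*_; _+_)
open import Data.Rational using (ℚ)
open import Data.Product using (_,_)

lemma4p5 : (ε k₀ c : ℚ) → StandingParams ε k₀ c →
    (k : ℕ) → 0 < k → (m : ℕ) → (C : Config k m) → IsConfig C → Good c C →
    (d : ℕ) → SolutionDim C d →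
    CertifiesAtMost C ((k ∸ d) * (k ∸ d + 1))
lemma4p5 ε k₀ c params k _ m C _ good d (B , B-sol , B-ind , _) pairs pairs! pairs-cert =
  GoodConfiguration.Counting.certified≤ {c = c} {C = C} (standingParams⇒63≤32c params) good B-sol B-ind pairs! pairs-cert
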